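{- Let $c'(m,n)$ be the number of partitions $(\lambda_1,\dots,\lambda_m)$ of $n$ into exactly $m$ positive parts satisfying $\lambda_i \geq \lambda_{i+1}$ and $\lambda_i \geq \lambda_{i+3}+3$ whenever the indices are in range. Then $$\sum_{m,n\ge0} c'(m,n) z^m q^n = \sum_{m_1,m_2,m_3\geq 0}\frac{q^{m_1(m_1+3)/2 + m_2(m_2+5)/2 + 3m_3 + (m_1+2m_2+3m_3)(m_1+2m_2+3m_3-3)/2}\, z^{m_1+2m_2+3m_3}}{(q)_{m_1}(q)_{m_2}(q)_{m_3}}.$$
   Context: Notation: $(q)_k = \prod_{i=1}^{k}(1-q^i)$. The empty partition counts as the unique partition of $0$ with $m=0$ parts. -}

module Defs where

open import Data.Nat as ℕ using (ℕ; zero; suc; _∸_; _≤ᵇ_; _≡ᵇ_)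
open import Data.Integer as ℤ using (ℤ; +_; ∣_∣; _≤?_)
open import Data.Integer.DivMod using (_/ℕ_)
open import Data.Bool using (Bool; true; false; _∧_; if_then_else_)
open import Data.List using (List; []; _∷_; map; concatMap; upTo; filterᵇ; length; zipWith; foldr; head)
open import Data.Maybe using (just; nothing)
open import Relation.Nullary using (yes; no)

comps : ℕ → ℕ → List (List ℕ)
comps zero zero = [] ∷ []
comps zero (suc _) = []
comps (suc m) n =
  concatMap (λ k → map (suc k ∷_) (comps m (n ∸ suc k))) (upTo n)

nonincr : List ℕ → Bool
nonincr (a ∷ b ∷ l) = (b ≤ᵇ a) ∧ nonincr (b ∷ l)
nonincr _ = true

gap3 : List ℕ → Bool
gap3 (a ∷ b ∷ c ∷ d ∷ l) = (d ℕ.+ 3 ≤ᵇ a) ∧ gap3 (b ∷ c ∷ d ∷ l)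
gap3 _ = true

c′ : ℕ → ℕ → ℕ
c′ m n = length (filterᵇ (λ l → nonincr l ∧ gap3 l) (comps m n))

sum : List ℤ → ℤ
sum = foldr ℤ._+_ (+ 0)

Series : Set
Series = ℕ → ℤ

infixl 7 _⊛_
_⊛_ : Series → Series → Series
(f ⊛ g) n = sum (map (λ k → f k ℤ.* g (n ∸ k)) (upTo (suc n)))

oneMinusQ : ℕ → Series
oneMinusQ i n = if n ≡ᵇ 0 then (if i ≡ᵇ 0 then + 0 else + 1)
                else (if n ≡ᵇ i then ℤ.- (+ 1) else + 0)

poch : ℕ → Series
poch zero n = if n ≡ᵇ 0 then + 1 else + 0
poch (suc k) = poch k ⊛ oneMinusQ (suc k)

-- multiplicative inverse of a series f with f 0 = 1:
-- g 0 = 1, g n = - Σ_{k=1}^{n} f k * g (n - k).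
-- invTab f n = [g n, g (n-1), …, g 0]
invTab : Series → ℕ → List ℤ
invTab f zero = + 1 ∷ []
invTab f (suc n) =
  ℤ.- sum (zipWith (λ j g → f (suc j) ℤ.* g) (upTo (suc n)) (invTab f n))
  ∷ invTab f n

inv : Series → Series
inv f n with head (invTab f n)
... | just x = x
... | nothing = + 0

-- multiplication by q^e for an integer e (coefficients at negative
-- exponents never arise in our use; they would be dropped)
shiftZ : ℤ → Series → Series
shiftZ e f n with e ≤? + n
... | yes _ = f ∣ + n ℤ.- e ∣
... | no _ = + 0

expo : ℕ → ℕ → ℕ → ℤ
expo m1 m2 m3 =
  (+ (m1 ℕ.* (m1 ℕ.+ 3)) ℤ.+ + (m2 ℕ.* (m2 ℕ.+ 5)) ℤ.+ + (6 ℕ.* m3)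
    ℤ.+ (+ M) ℤ.* (+ M ℤ.- + 3)) /ℕ 2
  where M = m1 ℕ.+ 2 ℕ.* m2 ℕ.+ 3 ℕ.* m3

term : ℕ → ℕ → ℕ → Series
term m1 m2 m3 = shiftZ (expo m1 m2 m3) (inv (poch m1 ⊛ poch m2 ⊛ poch m3))

rhsCoeff : ℕ → ℕ → ℤ
rhsCoeff m n =
  sum (map (λ m1 → sum (map (λ m2 → sum (map (λ m3 →
      if (m1 ℕ.+ 2 ℕ.* m2 ℕ.+ 3 ℕ.* m3) ≡ᵇ m then term m1 m2 m3 n else + 0)
    (upTo (suc m)))) (upTo (suc m)))) (upTo (suc m)))

{-# OPTIONS --safe #-}
module Submission where

-- A partition is counted by c′ when no four of its parts lie in a window {h, h+1, h+2}.
-- Deleting its first column (every part drops by one, the f parts equal to 1 vanish)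
-- leaves a partition of n − m into m − f parts, and the window condition becomes the same
-- condition for the smaller partition together with f + p + r ≤ 3, where p and r count the
-- parts that vanished at the two previous deletions. Hence the series
-- G_{p,r}(z) = Σ count p r m n z^m q^n, for p + r ≤ 3, satisfy
--   G_{p,r}(z) = Σ_{f ≤ 3-p-r} (zq)^f G_{f,p}(zq),   G_{p,r}(0) = 1,
-- and this system has only one solution. On the other side, put
--   F(a,b,c) = Σ_{i,j,k} z^{i+2j+3k} q^{C(i+2j+3k,2) + C(i+1,2) + C(j+1,2) + ai + bj + ck} / ((q)_i (q)_j (q)_k),
-- so that the right-hand side is F(0,0,0). Expanding 1/(q)_i = 1/(q)_{i-1} + q^i/(q)_i in each
-- index gives three linear relations between shifted F's, and F(a+1,b+2,c+3)(z) = F(a,b,c)(zq).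
-- Explicit combinations of F's, with G_{0,0} = F(0,0,0), solve the system; each of the ten
-- equations is reduced to a multiset identity by a rewriting certificate checked by evaluation.

open import Defs using (c′; rhsCoeff)
open import Data.Bool using (Bool; true; false; _∧_; if_then_else_; T)
open import Data.Empty using (⊥-elim)
open import Data.Nat as ℕ using (ℕ; zero; suc; _∸_; _≤ᵇ_; _≡ᵇ_; z≤n; s≤s)
import Data.Nat.Properties as ℕₚ
open import Data.Product using (_×_; _,_; ∃; ∃₂; proj₁; proj₂)
open import Function using (_∘_)
open import Relation.Binary.PropositionalEquality
open import Relation.Nullary.Reflects using (ofʸ; ofⁿ)
open ≡-Reasoning

≤ᵇ-true : ∀ {m n} → m ℕ.≤ n → (m ≤ᵇ n) ≡ true
≤ᵇ-true {m} {n} m≤n with m ≤ᵇ n | ℕₚ.≤ᵇ-reflects-≤ m n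
... | true  | _       = refl
... | false | ofⁿ m≰n = ⊥-elim (m≰n m≤n)

≤ᵇ-false : ∀ {m n} → n ℕ.< m → (m ≤ᵇ n) ≡ false
≤ᵇ-false {m} {n} n<m with m ≤ᵇ n | ℕₚ.≤ᵇ-reflects-≤ m n
... | false | _       = refl
... | true  | ofʸ m≤n = ⊥-elim (ℕₚ.<⇒≱ n<m m≤n)

≡ᵇ-false : ∀ {m n} → m ≢ n → (m ≡ᵇ n) ≡ false
≡ᵇ-false {m} {n} m≢n with m ≡ᵇ n in eq
... | false = refl
... | true  = ⊥-elim (m≢n (ℕₚ.≡ᵇ⇒≡ m n (subst T (sym eq) _)))

suc-≤ᵇ-suc : ∀ m n → (suc m ≤ᵇ suc n) ≡ (m ≤ᵇ n)
suc-≤ᵇ-suc zero    n = refl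
suc-≤ᵇ-suc (suc m) n = refl

module Partitions where

  open import Defs using (comps; nonincr; gap3)
  open import Algebra.Bundles using (CommutativeMonoid)
  open import Data.Bool.Properties using (∧-assoc; ∧-zeroʳ; ∧-commutativeMonoid; T?; T-∧)
  open import Algebra.Properties.CommutativeSemigroup (CommutativeMonoid.commutativeSemigroup ∧-commutativeMonoid)
    using () renaming (interchange to ∧-interchange)
  open import Data.List using (List; []; _∷_; _++_; map; replicate; length; filterᵇ; concatMap; upTo)
  import Data.List.Properties as List
  open import Data.List.Membership.Propositional using (_∈_; find; lose)
  open import Data.List.Membership.Propositional.Properties
    using (∈-map⁺; ∈-map⁻; ∈-concatMap⁺; ∈-concatMap⁻; ∈-upTo⁺; ∈-upTo⁻; ∈-filter⁺; ∈-filter⁻)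
  open import Data.List.Membership.Propositional.Properties.WithK using (unique∧set⇒bag)
  open import Data.List.Relation.Binary.BagAndSetEquality using (∼bag⇒↭)
  open import Data.List.Relation.Binary.Disjoint.Propositional using (Disjoint)
  open import Data.List.Relation.Binary.Permutation.Propositional.Properties using (↭-length)
  open import Data.List.Relation.Unary.All using (All; []; _∷_; universal)
  import Data.List.Relation.Unary.All.Properties as All
  open import Data.List.Relation.Unary.AllPairs as AllPairs using ([]; _∷_)
  import Data.List.Relation.Unary.AllPairs.Properties as AllPairsₚ
  open import Data.List.Relation.Unary.Any using (here)
  open import Data.List.Relation.Unary.Unique.Propositional using (Unique)
  import Data.List.Relation.Unary.Unique.Propositional.Properties as Unique
  open import Data.Nat using (_+_; _≤_; _<_)
  open import Data.Nat.ListAction using (sum)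
  open import Data.Nat.Properties
  open import Function.Bundles using (module Equivalence; mk⇔)
  open Equivalence using (to; from)

  admissible : List ℕ → Bool
  admissible l = nonincr l ∧ gap3 l

  headOK : ℕ → List ℕ → Bool
  headOK x []      = true
  headOK x (y ∷ _) = y ≤ᵇ x

  gapOK : ℕ → List ℕ → Bool
  gapOK x (_ ∷ _ ∷ d ∷ _) = d + 3 ≤ᵇ x
  gapOK x _               = true

  nonincr-∷ : ∀ x l → nonincr (x ∷ l) ≡ headOK x l ∧ nonincr l
  nonincr-∷ x []      = refl
  nonincr-∷ x (y ∷ l) = refl

  gap3-∷ : ∀ x l → gap3 (x ∷ l) ≡ gapOK x l ∧ gap3 l
  gap3-∷ x []                = refl
  gap3-∷ x (_ ∷ [])          = refl
  gap3-∷ x (_ ∷ _ ∷ [])      = refl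
  gap3-∷ x (_ ∷ _ ∷ _ ∷ _)   = refl

  admissible-∷ : ∀ x l → admissible (x ∷ l) ≡ headOK x l ∧ (gapOK x l ∧ admissible l)
  admissible-∷ x l = begin
    nonincr (x ∷ l) ∧ gap3 (x ∷ l)                   ≡⟨ cong₂ _∧_ (nonincr-∷ x l) (gap3-∷ x l) ⟩
    (headOK x l ∧ nonincr l) ∧ (gapOK x l ∧ gap3 l)  ≡⟨ ∧-interchange (headOK x l) _ _ _ ⟩
    (headOK x l ∧ gapOK x l) ∧ admissible l          ≡⟨ ∧-assoc (headOK x l) _ _ ⟩
    headOK x l ∧ (gapOK x l ∧ admissible l)          ∎

  headOK-map-suc : ∀ x l → headOK (suc x) (map suc l) ≡ headOK x l
  headOK-map-suc x []      = refl
  headOK-map-suc x (y ∷ l) = suc-≤ᵇ-suc y x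

  gapOK-map-suc : ∀ x l → gapOK (suc x) (map suc l) ≡ gapOK x l
  gapOK-map-suc x []              = refl
  gapOK-map-suc x (_ ∷ [])        = refl
  gapOK-map-suc x (_ ∷ _ ∷ [])    = refl
  gapOK-map-suc x (_ ∷ _ ∷ d ∷ _) = suc-≤ᵇ-suc (d + 3) x

  admissible-map-suc : ∀ l → admissible (map suc l) ≡ admissible l
  admissible-map-suc []      = refl
  admissible-map-suc (x ∷ l) = begin
    admissible (suc x ∷ map suc l)                                                ≡⟨ admissible-∷ (suc x) (map suc l) ⟩
    headOK (suc x) (map suc l) ∧ (gapOK (suc x) (map suc l) ∧ admissible (map suc l))
      ≡⟨ cong₂ _∧_ (headOK-map-suc x l) (cong₂ _∧_ (gapOK-map-suc x l) (admissible-map-suc l)) ⟩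
    headOK x l ∧ (gapOK x l ∧ admissible l)                                       ≡⟨ admissible-∷ x l ⟨
    admissible (x ∷ l)                                                            ∎

  gap3-parts≤3 : ∀ l → All (λ v → 1 ≤ v × v ≤ 3) l → gap3 l ≡ (length l ≤ᵇ 3)
  gap3-parts≤3 []                  _ = refl
  gap3-parts≤3 (_ ∷ [])            _ = refl
  gap3-parts≤3 (_ ∷ _ ∷ [])        _ = refl
  gap3-parts≤3 (_ ∷ _ ∷ _ ∷ [])    _ = refl
  gap3-parts≤3 (a ∷ b ∷ c ∷ d ∷ l) ((_ , a≤3) ∷ _ ∷ _ ∷ (1≤d , _) ∷ _) =
    cong (_∧ gap3 (b ∷ c ∷ d ∷ l)) (≤ᵇ-false (≤-trans (s≤s a≤3) (+-monoˡ-≤ 3 1≤d)))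

  nonincr-replicate-++ : ∀ f a R → All (_≤ a) R → nonincr R ≡ true → nonincr (replicate f a ++ R) ≡ true
  nonincr-replicate-++ zero    a R R≤a R↓ = R↓
  nonincr-replicate-++ (suc f) a R R≤a R↓ =
    trans (nonincr-∷ a (replicate f a ++ R)) (cong₂ _∧_ (head-≤ f R R≤a) (nonincr-replicate-++ f a R R≤a R↓))
    where
    head-≤ : ∀ f R → All (_≤ a) R → headOK a (replicate f a ++ R) ≡ true
    head-≤ (suc f) R       _         = ≤ᵇ-true (≤-refl {a})
    head-≤ zero    []      []        = refl
    head-≤ zero    (_ ∷ _) (x≤a ∷ _) = ≤ᵇ-true x≤a

  admissible-3ᶠ2ᵖ1ʳ : ∀ f p r → admissible (replicate f 3 ++ replicate p 2 ++ replicate r 1) ≡ (f + p + r ≤ᵇ 3)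
  admissible-3ᶠ2ᵖ1ʳ f p r = cong₂ _∧_ nonincreasing (trans (gap3-parts≤3 _ bounded) (cong (_≤ᵇ 3) len))
    where
    1ʳ↓ : nonincr (replicate r 1) ≡ true
    1ʳ↓ = trans (cong nonincr (sym (List.++-identityʳ (replicate r 1)))) (nonincr-replicate-++ r 1 [] [] refl)
    nonincreasing : nonincr (replicate f 3 ++ replicate p 2 ++ replicate r 1) ≡ true
    nonincreasing = nonincr-replicate-++ f 3 _ (All.++⁺ (All.replicate⁺ p (s≤s (s≤s z≤n))) (All.replicate⁺ r (s≤s z≤n)))
                     (nonincr-replicate-++ p 2 _ (All.replicate⁺ r (s≤s z≤n)) 1ʳ↓)
    bounded : All (λ v → 1 ≤ v × v ≤ 3) (replicate f 3 ++ replicate p 2 ++ replicate r 1)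
    bounded = All.++⁺ (All.replicate⁺ f (s≤s z≤n , ≤-refl))
               (All.++⁺ (All.replicate⁺ p (s≤s z≤n , s≤s (s≤s z≤n))) (All.replicate⁺ r (s≤s z≤n , s≤s z≤n)))
    len : length (replicate f 3 ++ replicate p 2 ++ replicate r 1) ≡ f + p + r
    len = begin
      length (replicate f 3 ++ replicate p 2 ++ replicate r 1)
        ≡⟨ List.length-++ (replicate f 3) ⟩
      length (replicate f 3) + length (replicate p 2 ++ replicate r 1)
        ≡⟨ cong₂ _+_ (List.length-replicate f) (trans (List.length-++ (replicate p 2))
                                                    (cong₂ _+_ (List.length-replicate p) (List.length-replicate r))) ⟩
      f + (p + r)
        ≡⟨ +-assoc f p r ⟨
      f + p + r
        ∎

  headOK-raise : ∀ a Y r → headOK (suc a) (map suc Y ++ replicate r 1) ≡ headOK a Y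
  headOK-raise a []      zero    = refl
  headOK-raise a []      (suc r) = refl
  headOK-raise a (y ∷ Y) r       = suc-≤ᵇ-suc y a

  gapOK-raise : ∀ a Y r → 3 ≤ a → gapOK (suc a) (map suc Y ++ replicate r 1) ≡ gapOK a Y
  gapOK-raise a []              zero                = λ _ → refl
  gapOK-raise a []              (suc zero)          = λ _ → refl
  gapOK-raise a []              (suc (suc zero))    = λ _ → refl
  gapOK-raise a []              (suc (suc (suc r))) = ≤ᵇ-true ∘ s≤s
  gapOK-raise a (_ ∷ [])        zero                = λ _ → refl
  gapOK-raise a (_ ∷ [])        (suc zero)          = λ _ → refl
  gapOK-raise a (_ ∷ [])        (suc (suc r))       = ≤ᵇ-true ∘ s≤s
  gapOK-raise a (_ ∷ _ ∷ [])    zero                = λ _ → refl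
  gapOK-raise a (_ ∷ _ ∷ [])    (suc r)             = ≤ᵇ-true ∘ s≤s
  gapOK-raise a (_ ∷ _ ∷ d ∷ _) r                   = λ _ → suc-≤ᵇ-suc (d + 3) a

  map-suc-staircase : ∀ A f p r → map suc (A ++ replicate f 2 ++ replicate p 1) ++ replicate r 1
                                  ≡ map suc A ++ replicate f 3 ++ replicate p 2 ++ replicate r 1
  map-suc-staircase A f p r = begin
    map suc (A ++ replicate f 2 ++ replicate p 1) ++ replicate r 1
      ≡⟨ cong (_++ replicate r 1) (List.map-++ suc A (replicate f 2 ++ replicate p 1)) ⟩
    (map suc A ++ map suc (replicate f 2 ++ replicate p 1)) ++ replicate r 1
      ≡⟨ List.++-assoc (map suc A) _ _ ⟩
    map suc A ++ map suc (replicate f 2 ++ replicate p 1) ++ replicate r 1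
      ≡⟨ cong (λ xs → map suc A ++ xs ++ replicate r 1)
              (trans (List.map-++ suc (replicate f 2) _) (cong₂ _++_ (List.map-replicate suc f 2) (List.map-replicate suc p 1))) ⟩
    map suc A ++ (replicate f 3 ++ replicate p 2) ++ replicate r 1
      ≡⟨ cong (map suc A ++_) (List.++-assoc (replicate f 3) _ _) ⟩
    map suc A ++ replicate f 3 ++ replicate p 2 ++ replicate r 1
      ∎

  ≤ᵇ-∧-+≤ᵇ : ∀ x y b → (x ≤ᵇ b) ∧ (x + y ≤ᵇ b) ≡ (x + y ≤ᵇ b)
  ≤ᵇ-∧-+≤ᵇ x y b with x + y ≤ᵇ b | ≤ᵇ-reflects-≤ (x + y) b
  ... | true  | ofʸ x+y≤b = cong (_∧ true) (≤ᵇ-true (m+n≤o⇒m≤o x x+y≤b))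
  ... | false | _         = ∧-zeroʳ (x ≤ᵇ b)

  -- After raising, the parts ≤ 3 are the last f + p + r ones, and the gap condition forbids four of them.
  admissible-raise : ∀ A f p r → All (3 ≤_) A →
    admissible (map suc (A ++ replicate f 2 ++ replicate p 1) ++ replicate r 1)
      ≡ admissible (A ++ replicate f 2 ++ replicate p 1) ∧ (f + p + r ≤ᵇ 3)
  admissible-raise [] f p r [] = begin
    admissible (map suc (replicate f 2 ++ replicate p 1) ++ replicate r 1)
      ≡⟨ cong admissible (map-suc-staircase [] f p r) ⟩
    admissible (replicate f 3 ++ replicate p 2 ++ replicate r 1)
      ≡⟨ admissible-3ᶠ2ᵖ1ʳ f p r ⟩
    (f + p + r ≤ᵇ 3)
      ≡⟨ ≤ᵇ-∧-+≤ᵇ (f + p) r 3 ⟨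
    (f + p ≤ᵇ 3) ∧ (f + p + r ≤ᵇ 3)
      ≡⟨ cong (_∧ (f + p + r ≤ᵇ 3)) (admissible-3ᶠ2ᵖ1ʳ 0 f p) ⟨
    admissible (replicate f 2 ++ replicate p 1) ∧ (f + p + r ≤ᵇ 3)
      ∎
  admissible-raise (a ∷ A) f p r (3≤a ∷ 3≤A) = begin
    admissible (suc a ∷ map suc Y ++ replicate r 1)
      ≡⟨ admissible-∷ (suc a) (map suc Y ++ replicate r 1) ⟩
    headOK (suc a) (map suc Y ++ replicate r 1) ∧ (gapOK (suc a) (map suc Y ++ replicate r 1) ∧ admissible (map suc Y ++ replicate r 1))
      ≡⟨ cong₂ _∧_ (headOK-raise a Y r) (cong₂ _∧_ (gapOK-raise a Y r 3≤a) (admissible-raise A f p r 3≤A)) ⟩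
    headOK a Y ∧ (gapOK a Y ∧ (admissible Y ∧ fits))
      ≡⟨ cong (headOK a Y ∧_) (∧-assoc (gapOK a Y) _ _) ⟨
    headOK a Y ∧ ((gapOK a Y ∧ admissible Y) ∧ fits)
      ≡⟨ ∧-assoc (headOK a Y) _ _ ⟨
    (headOK a Y ∧ (gapOK a Y ∧ admissible Y)) ∧ fits
      ≡⟨ cong (_∧ fits) (admissible-∷ a Y) ⟨
    admissible (a ∷ Y) ∧ fits
      ∎
    where
    Y = A ++ replicate f 2 ++ replicate p 1
    fits = f + p + r ≤ᵇ 3

  IsComposition : ℕ → ℕ → List ℕ → Set
  IsComposition m n l = length l ≡ m × sum l ≡ n × All (1 ≤_) l

  ∈-comps⁻ : ∀ m n {l} → l ∈ comps m n → IsComposition m n l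
  ∈-comps⁻ zero    zero    (here refl) = refl , refl , []
  ∈-comps⁻ (suc m) n       l∈
    with k , k∈ , l∈′ ← find (∈-concatMap⁻ (λ k → map (suc k ∷_) (comps m (n ∸ suc k))) {xs = upTo n} l∈)
    with l′ , l′∈ , refl ← ∈-map⁻ (suc k ∷_) l∈′
    with len , total , 1≤l′ ← ∈-comps⁻ m (n ∸ suc k) l′∈
    = cong suc len , trans (cong (suc k +_) total) (m+[n∸m]≡n (∈-upTo⁻ k∈)) , s≤s z≤n ∷ 1≤l′

  ∈-comps⁺ : ∀ m n {l} → IsComposition m n l → l ∈ comps m n
  ∈-comps⁺ zero    zero    {[]}        _                          = here refl
  ∈-comps⁺ (suc m) n       {suc k ∷ l} (len , total , _ ∷ 1≤l) =
    ∈-concatMap⁺ (λ k → map (suc k ∷_) (comps m (n ∸ suc k))) {xs = upTo n}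
      (lose (∈-upTo⁺ k<n) (∈-map⁺ (suc k ∷_) (∈-comps⁺ m (n ∸ suc k) (suc-injective len , total′ , 1≤l))))
    where
    k<n : k < n
    k<n = subst (suc k ≤_) total (m≤m+n (suc k) (sum l))
    total′ : sum l ≡ n ∸ suc k
    total′ = trans (sym (m+n∸m≡n (suc k) (sum l))) (cong (_∸ suc k) total)

  comps-unique : ∀ m n → Unique (comps m n)
  comps-unique zero    zero    = [] ∷ []
  comps-unique zero    (suc n) = []
  comps-unique (suc m) n       =
    Unique.concat⁺ (All.map⁺ (universal (λ k → Unique.map⁺ List.∷-injectiveʳ (comps-unique m (n ∸ suc k))) (upTo n)))
                   (AllPairsₚ.map⁺ (AllPairs.map disjoint (Unique.upTo⁺ n)))
    where
    disjoint : ∀ {i j} → i ≢ j → Disjoint (map (suc i ∷_) (comps m (n ∸ suc i))) (map (suc j ∷_) (comps m (n ∸ suc j)))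
    disjoint {i} {j} i≢j (vi , vj) with ∈-map⁻ (suc i ∷_) vi | ∈-map⁻ (suc j ∷_) vj
    ... | _ , _ , refl | _ , _ , eq = i≢j (suc-injective (List.∷-injectiveˡ eq))

  -- μ with the last two deleted columns put back: the p parts that vanished last return as 2s,
  -- the r parts that vanished before them as 1s.
  admissibleOver : ℕ → ℕ → List ℕ → Bool
  admissibleOver p r μ = admissible (map (2 +_) μ ++ replicate p 2 ++ replicate r 1)

  addColumn : ℕ → List ℕ → List ℕ
  addColumn f μ = map suc μ ++ replicate f 1

  map-2+-addColumn : ∀ f μ R → map (2 +_) (addColumn f μ) ++ R ≡ map suc (map (2 +_) μ) ++ replicate f 3 ++ R
  map-2+-addColumn f μ R = begin
    map (2 +_) (map suc μ ++ replicate f 1) ++ R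
      ≡⟨ cong (_++ R) (List.map-++ (2 +_) (map suc μ) (replicate f 1)) ⟩
    (map (2 +_) (map suc μ) ++ map (2 +_) (replicate f 1)) ++ R
      ≡⟨ List.++-assoc (map (2 +_) (map suc μ)) _ R ⟩
    map (2 +_) (map suc μ) ++ map (2 +_) (replicate f 1) ++ R
      ≡⟨ cong₂ (λ xs ys → xs ++ ys ++ R) (trans (sym (List.map-∘ μ)) (List.map-∘ μ)) (List.map-replicate (2 +_) f 1) ⟩
    map suc (map (2 +_) μ) ++ replicate f 3 ++ R
      ∎

  admissibleOver-addColumn : ∀ p r f μ → All (1 ≤_) μ →
    admissibleOver p r (addColumn f μ) ≡ admissibleOver f p μ ∧ (f + p + r ≤ᵇ 3)
  admissibleOver-addColumn p r f μ 1≤μ = begin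
    admissible (map (2 +_) (addColumn f μ) ++ replicate p 2 ++ replicate r 1)
      ≡⟨ cong admissible (map-2+-addColumn f μ (replicate p 2 ++ replicate r 1)) ⟩
    admissible (map suc (map (2 +_) μ) ++ replicate f 3 ++ replicate p 2 ++ replicate r 1)
      ≡⟨ cong admissible (map-suc-staircase (map (2 +_) μ) f p r) ⟨
    admissible (map suc (map (2 +_) μ ++ replicate f 2 ++ replicate p 1) ++ replicate r 1)
      ≡⟨ admissible-raise (map (2 +_) μ) f p r (raised 1≤μ) ⟩
    admissibleOver f p μ ∧ (f + p + r ≤ᵇ 3)
      ∎
    where
    raised : ∀ {μ} → All (1 ≤_) μ → All (3 ≤_) (map (2 +_) μ)
    raised []          = []
    raised (1≤x ∷ 1≤μ) = s≤s (s≤s 1≤x) ∷ raised 1≤μ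

  admissible≡admissibleOver-0-0 : ∀ l → admissible l ≡ admissibleOver 0 0 l
  admissible≡admissibleOver-0-0 l = sym (begin
    admissible (map (2 +_) l ++ [])        ≡⟨ cong admissible (List.++-identityʳ (map (2 +_) l)) ⟩
    admissible (map (suc ∘ suc) l)         ≡⟨ cong admissible (List.map-∘ l) ⟩
    admissible (map suc (map suc l))       ≡⟨ admissible-map-suc (map suc l) ⟩
    admissible (map suc l)                 ≡⟨ admissible-map-suc l ⟩
    admissible l                           ∎)

  nonincr-map-suc : ∀ l → nonincr (map suc l) ≡ nonincr l
  nonincr-map-suc []      = refl
  nonincr-map-suc (x ∷ l) = trans (nonincr-∷ (suc x) (map suc l))
    (trans (cong₂ _∧_ (headOK-map-suc x l) (nonincr-map-suc l)) (sym (nonincr-∷ x l)))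

  nonincr-++⁻ˡ : ∀ xs ys → T (nonincr (xs ++ ys)) → T (nonincr xs)
  nonincr-++⁻ˡ []           ys _  = _
  nonincr-++⁻ˡ (x ∷ [])     ys _  = _
  nonincr-++⁻ˡ (x ∷ y ∷ xs) ys ok =
    from T-∧ (proj₁ (to T-∧ ok) , nonincr-++⁻ˡ (y ∷ xs) ys (proj₂ (to T-∧ ok)))

  admissibleOver⇒nonincr : ∀ p r l → T (admissibleOver p r l) → T (nonincr l)
  admissibleOver⇒nonincr p r l ok = subst T eq (nonincr-++⁻ˡ (map (2 +_) l) _ (proj₁ (to T-∧ ok)))
    where
    eq : nonincr (map (2 +_) l) ≡ nonincr l
    eq = trans (cong nonincr (List.map-∘ l)) (trans (nonincr-map-suc (map suc l)) (nonincr-map-suc l))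

  decompose : ∀ l → T (nonincr l) → All (1 ≤_) l → ∃₂ λ f μ → l ≡ addColumn f μ × All (1 ≤_) μ
  decompose []                _  _         = 0 , [] , refl , []
  decompose (suc zero ∷ l)    ↓  (_ ∷ 1≤l) = suc (length l) , [] , cong (1 ∷_) (ones l ↓ 1≤l) , []
    where
    ones : ∀ l → T (nonincr (1 ∷ l)) → All (1 ≤_) l → l ≡ replicate (length l) 1
    ones []                   _ _         = refl
    ones (suc zero ∷ l)       ↓ (_ ∷ 1≤l) = cong (1 ∷_) (ones l ↓ 1≤l)
  decompose (suc (suc x) ∷ l) ↓  (_ ∷ 1≤l)
    with f , μ , refl , 1≤μ ← decompose l (proj₂ (to T-∧ (subst T (nonincr-∷ (suc (suc x)) l) ↓))) 1≤l
    = f , suc x ∷ μ , refl , s≤s z≤n ∷ 1≤μ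

  addColumn-injective : ∀ {f g} μ ν → All (1 ≤_) μ → All (1 ≤_) ν → addColumn f μ ≡ addColumn g ν → f ≡ g × μ ≡ ν
  addColumn-injective {f} {g} []      []      _              _              eq =
    trans (sym (List.length-replicate f)) (trans (cong length eq) (List.length-replicate g)) , refl
  addColumn-injective {g = zero}  (_ ∷ _) [] _ _ ()
  addColumn-injective {g = suc _} (_ ∷ _) [] (s≤s z≤n ∷ _) _ ()
  addColumn-injective {f = zero}  [] (_ ∷ _) _ _ ()
  addColumn-injective {f = suc _} [] (_ ∷ _) _ (s≤s z≤n ∷ _) ()
  addColumn-injective (x ∷ μ) (y ∷ ν) (_ ∷ 1≤μ) (_ ∷ 1≤ν) eq
    with refl ← suc-injective (List.∷-injectiveˡ eq)
    with refl , refl ← addColumn-injective μ ν 1≤μ 1≤ν (List.∷-injectiveʳ eq)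
    = refl , refl

  length-addColumn : ∀ f μ → length (addColumn f μ) ≡ length μ + f
  length-addColumn f μ = trans (List.length-++ (map suc μ)) (cong₂ _+_ (List.length-map suc μ) (List.length-replicate f))

  sum-addColumn : ∀ f μ → sum (addColumn f μ) ≡ sum μ + length (addColumn f μ)
  sum-addColumn zero    []      = refl
  sum-addColumn (suc f) []      = cong suc (sum-addColumn f [])
  sum-addColumn f       (x ∷ μ) = begin
    suc x + sum (addColumn f μ)                 ≡⟨ cong (suc x +_) (sum-addColumn f μ) ⟩
    suc x + (sum μ + length (addColumn f μ))    ≡⟨ cong suc (+-assoc x (sum μ) _) ⟨
    suc (x + sum μ + length (addColumn f μ))    ≡⟨ +-suc (x + sum μ) _ ⟨
    x + sum μ + suc (length (addColumn f μ))    ∎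

  addColumn-composition⁻ : ∀ M n f μ → All (1 ≤_) μ → IsComposition M n (addColumn f μ) →
    f ≤ M × M ≤ n × IsComposition (M ∸ f) (n ∸ M) μ
  addColumn-composition⁻ M n f μ 1≤μ (len , total , _) = f≤M , M≤n , length-μ , sum-μ , 1≤μ
    where
    len′ : length μ + f ≡ M
    len′ = trans (sym (length-addColumn f μ)) len
    total′ : sum μ + M ≡ n
    total′ = trans (cong (sum μ +_) (sym len)) (trans (sym (sum-addColumn f μ)) total)
    f≤M : f ≤ M
    f≤M = subst (f ≤_) len′ (m≤n+m f (length μ))
    M≤n : M ≤ n
    M≤n = subst (M ≤_) total′ (m≤n+m M (sum μ))
    length-μ : length μ ≡ M ∸ f
    length-μ = trans (sym (m+n∸n≡m (length μ) f)) (cong (_∸ f) len′)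
    sum-μ : sum μ ≡ n ∸ M
    sum-μ = trans (sym (m+n∸n≡m (sum μ) M)) (cong (_∸ M) total′)

  addColumn-composition⁺ : ∀ M n f μ → f ≤ M → M ≤ n → IsComposition (M ∸ f) (n ∸ M) μ → IsComposition M n (addColumn f μ)
  addColumn-composition⁺ M n f μ f≤M M≤n (len , total , 1≤μ) = len′ , total′ , 1≤addColumn
    where
    len′ : length (addColumn f μ) ≡ M
    len′ = trans (length-addColumn f μ) (trans (cong (_+ f) len) (m∸n+n≡m f≤M))
    total′ : sum (addColumn f μ) ≡ n
    total′ = trans (sum-addColumn f μ) (trans (cong₂ _+_ total len′) (m∸n+n≡m M≤n))
    1≤addColumn : All (1 ≤_) (addColumn f μ)
    1≤addColumn = All.++⁺ (All.map⁺ (universal (λ _ → s≤s z≤n) μ)) (All.replicate⁺ f (s≤s z≤n))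

  count : ℕ → ℕ → ℕ → ℕ → ℕ
  count p r m n = length (filterᵇ (admissibleOver p r) (comps m n))

  block : ℕ → ℕ → ℕ → ℕ → List (List ℕ)
  block p f M n =
    if M ≤ᵇ n then (if f ≤ᵇ M then map (addColumn f) (filterᵇ (admissibleOver f p) (comps (M ∸ f) (n ∸ M))) else []) else []

  blocks : ℕ → ℕ → ℕ → ℕ → List (List ℕ)
  blocks p r M n = concatMap (λ f → block p f M n) (upTo (4 ∸ (p + r)))

  length-block : ∀ p f M n → length (block p f M n) ≡ (if M ≤ᵇ n then (if f ≤ᵇ M then count f p (M ∸ f) (n ∸ M) else 0) else 0)
  length-block p f M n with M ≤ᵇ n | f ≤ᵇ M
  ... | true  | true  = List.length-map (addColumn f) (filterᵇ (admissibleOver f p) (comps (M ∸ f) (n ∸ M)))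
  ... | true  | false = refl
  ... | false | _     = refl

  ∈-block⁻ : ∀ p f M n {v} → v ∈ block p f M n →
    M ≤ n × f ≤ M × ∃ λ μ → IsComposition (M ∸ f) (n ∸ M) μ × T (admissibleOver f p μ) × v ≡ addColumn f μ
  ∈-block⁻ p f M n v∈ with M ≤ᵇ n | ≤ᵇ-reflects-≤ M n | f ≤ᵇ M | ≤ᵇ-reflects-≤ f M
  ... | true | ofʸ M≤n | true | ofʸ f≤M
    with μ , μ∈ , refl ← ∈-map⁻ (addColumn f) v∈
    with μ∈comps , ok ← ∈-filter⁻ (T? ∘ admissibleOver f p) μ∈
    = M≤n , f≤M , μ , ∈-comps⁻ (M ∸ f) (n ∸ M) μ∈comps , ok , refl

  ∈-block⁺ : ∀ p f M n μ → M ≤ n → f ≤ M → IsComposition (M ∸ f) (n ∸ M) μ → T (admissibleOver f p μ) →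
    addColumn f μ ∈ block p f M n
  ∈-block⁺ p f M n μ M≤n f≤M comp ok rewrite ≤ᵇ-true M≤n | ≤ᵇ-true f≤M =
    ∈-map⁺ (addColumn f) (∈-filter⁺ (T? ∘ admissibleOver f p) (∈-comps⁺ (M ∸ f) (n ∸ M) comp) ok)

  block-unique : ∀ p f M n → Unique (block p f M n)
  block-unique p f M n with M ≤ᵇ n | f ≤ᵇ M
  ... | true  | true  = Unique.map⁺ injective (Unique.filter⁺ (T? ∘ admissibleOver f p) (comps-unique (M ∸ f) (n ∸ M)))
    where
    injective : ∀ {μ ν} → addColumn f μ ≡ addColumn f ν → μ ≡ ν
    injective {μ} {ν} = List.map-injective suc-injective ∘ List.++-cancelʳ (replicate f 1) (map suc μ) (map suc ν)
  ... | true  | false = []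
  ... | false | _     = []

  <4∸⇒+≤3 : ∀ f p r → p + r ≤ 3 → f < 4 ∸ (p + r) → f + p + r ≤ 3
  <4∸⇒+≤3 f p r p+r≤3 f<4∸ =
    subst (_≤ 3) (sym (+-assoc f p r)) (≤-pred (m≤o∸n⇒m+n≤o (suc f) (m≤n⇒m≤1+n p+r≤3) f<4∸))

  +≤3⇒<4∸ : ∀ f p r → f + p + r ≤ 3 → f < 4 ∸ (p + r)
  +≤3⇒<4∸ f p r f+p+r≤3 = m+n≤o⇒m≤o∸n (suc f) (s≤s (subst (_≤ 3) (+-assoc f p r) f+p+r≤3))

  blocks-unique : ∀ p r M n → Unique (blocks p r M n)
  blocks-unique p r M n = Unique.concat⁺ (All.map⁺ (universal (λ f → block-unique p f M n) (upTo (4 ∸ (p + r)))))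
                                         (AllPairsₚ.map⁺ (AllPairs.map disjoint (Unique.upTo⁺ (4 ∸ (p + r)))))
    where
    disjoint : ∀ {i j} → i ≢ j → Disjoint (block p i M n) (block p j M n)
    disjoint {i} {j} i≢j (vi , vj)
      with _ , _ , μ , (_ , _ , 1≤μ) , _ , refl ← ∈-block⁻ p i M n vi
      with _ , _ , ν , (_ , _ , 1≤ν) , _ , eq   ← ∈-block⁻ p j M n vj
      = i≢j (proj₁ (addColumn-injective μ ν 1≤μ 1≤ν eq))

  unique∧set⇒length≡ : ∀ {A : Set} {xs ys : List A} → Unique xs → Unique ys →
    (∀ {v} → v ∈ xs → v ∈ ys) → (∀ {v} → v ∈ ys → v ∈ xs) → length xs ≡ length ys
  unique∧set⇒length≡ xs! ys! xs⊆ys ys⊆xs = ↭-length (∼bag⇒↭ (unique∧set⇒bag xs! ys! (mk⇔ xs⊆ys ys⊆xs)))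

  count≡length-blocks : ∀ p r M n → p + r ≤ 3 → count p r M n ≡ length (blocks p r M n)
  count≡length-blocks p r M n p+r≤3 =
    unique∧set⇒length≡ (Unique.filter⁺ (T? ∘ admissibleOver p r) (comps-unique M n)) (blocks-unique p r M n) into onto
    where
    into : ∀ {v} → v ∈ filterᵇ (admissibleOver p r) (comps M n) → v ∈ blocks p r M n
    into {v} v∈
      with v∈comps , ok ← ∈-filter⁻ (T? ∘ admissibleOver p r) v∈
      with comp@(_ , _ , 1≤v) ← ∈-comps⁻ M n v∈comps
      with f , μ , refl , 1≤μ ← decompose v (admissibleOver⇒nonincr p r v ok) 1≤v
      with f≤M , M≤n , compμ ← addColumn-composition⁻ M n f μ 1≤μ comp
      with okμ , fits ← to T-∧ (subst T (admissibleOver-addColumn p r f μ 1≤μ) ok)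
      = ∈-concatMap⁺ (λ f → block p f M n) {xs = upTo (4 ∸ (p + r))}
          (lose (∈-upTo⁺ (+≤3⇒<4∸ f p r (≤ᵇ⇒≤ _ 3 fits))) (∈-block⁺ p f M n μ M≤n f≤M compμ okμ))
    onto : ∀ {v} → v ∈ blocks p r M n → v ∈ filterᵇ (admissibleOver p r) (comps M n)
    onto v∈
      with f , f∈ , v∈block ← find (∈-concatMap⁻ (λ f → block p f M n) {xs = upTo (4 ∸ (p + r))} v∈)
      with M≤n , f≤M , μ , compμ@(_ , _ , 1≤μ) , okμ , refl ← ∈-block⁻ p f M n v∈block
      = ∈-filter⁺ (T? ∘ admissibleOver p r) (∈-comps⁺ M n (addColumn-composition⁺ M n f μ f≤M M≤n compμ))
          (subst T (sym (admissibleOver-addColumn p r f μ 1≤μ))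
                   (from T-∧ (okμ , ≤⇒≤ᵇ (<4∸⇒+≤3 f p r p+r≤3 (∈-upTo⁻ f∈)))))

  length-concatMap : ∀ {A B : Set} (g : A → List B) xs → length (concatMap g xs) ≡ sum (map (length ∘ g) xs)
  length-concatMap g []       = refl
  length-concatMap g (x ∷ xs) = trans (List.length-++ (g x)) (cong (length (g x) +_) (length-concatMap g xs))

  count-rec : ∀ p r M n → p + r ≤ 3 →
    count p r M n ≡ sum (map (λ f → if M ≤ᵇ n then (if f ≤ᵇ M then count f p (M ∸ f) (n ∸ M) else 0) else 0)
                             (upTo (4 ∸ (p + r))))
  count-rec p r M n p+r≤3 = begin
    count p r M n
      ≡⟨ count≡length-blocks p r M n p+r≤3 ⟩
    length (blocks p r M n)
      ≡⟨ length-concatMap (λ f → block p f M n) (upTo (4 ∸ (p + r))) ⟩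
    sum (map (λ f → length (block p f M n)) (upTo (4 ∸ (p + r))))
      ≡⟨ cong sum (List.map-cong (λ f → length-block p f M n) (upTo (4 ∸ (p + r)))) ⟩
    sum (map (λ f → if M ≤ᵇ n then (if f ≤ᵇ M then count f p (M ∸ f) (n ∸ M) else 0) else 0) (upTo (4 ∸ (p + r))))
      ∎

  admissibleOver-[] : ∀ p r → p + r ≤ 3 → admissibleOver p r [] ≡ true
  admissibleOver-[] p r p+r≤3 = trans (admissible-3ᶠ2ᵖ1ʳ 0 p r) (≤ᵇ-true p+r≤3)

  count-at-z⁰ : ∀ p r → p + r ≤ 3 → count p r 0 0 ≡ 1
  count-at-z⁰ p r p+r≤3 with admissibleOver p r [] | admissibleOver-[] p r p+r≤3
  ... | true | refl = refl

  filterᵇ-cong : ∀ {A : Set} {P Q : A → Bool} → (∀ x → P x ≡ Q x) → ∀ xs → filterᵇ P xs ≡ filterᵇ Q xs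
  filterᵇ-cong P≗Q []       = refl
  filterᵇ-cong {P = P} {Q} P≗Q (x ∷ xs) with P x | Q x | P≗Q x
  ... | true  | true  | refl = cong (x ∷_) (filterᵇ-cong P≗Q xs)
  ... | false | false | refl = filterᵇ-cong P≗Q xs

  c′≡count : ∀ m n → c′ m n ≡ count 0 0 m n
  c′≡count m n = cong length (filterᵇ-cong admissible≡admissibleOver-0-0 (comps m n))

module QSeries where

  open import Defs using (Series; sum; _⊛_; oneMinusQ; poch; invTab; inv; shiftZ; expo; term)
  open import Data.Bool.Properties using (if-eta; if-float)
  open import Data.Integer as ℤ using (ℤ; +_; _+_; _*_; -_; _-_; _⊖_; _/ℕ_; +≤+)
  open import Data.Integer.Properties
  open import Algebra.Properties.CommutativeSemigroup +-commutativeSemigroup using (interchange; x∙yz≈y∙xz)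
  open import Data.List using (List; []; _∷_; _++_; map; concatMap; null; upTo; applyUpTo; zipWith)
  open import Data.List.Relation.Unary.All using (All; []; _∷_)
  open import Data.Maybe as Maybe using (Maybe; just; nothing)
  open import Data.Nat.DivMod using (m*n/n≡m)
  open import Data.Nat.ListAction using () renaming (sum to sumℕ)
  open import Data.Nat.Solver using (module +-*-Solver)
  open +-*-Solver using (solve; _:+_; _:*_; _:=_; con)
  open import Data.Product.Properties using (≡-dec)
  open import Data.Sum using (inj₁; inj₂)
  open import Relation.Binary.Definitions using (DecidableEquality)
  open import Relation.Nullary using (yes; no)
  open Partitions using (count; count-rec; count-at-z⁰; <4∸⇒+≤3)

  ∑ : ℕ → (ℕ → ℤ) → ℤ
  ∑ zero    f = + 0
  ∑ (suc n) f = f 0 + ∑ n (f ∘ suc)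

  infix 6.5 ∑
  syntax ∑ n (λ i → f) = ∑[ i < n ] f

  sum-map-upTo : ∀ (h : ℕ → ℤ) n → sum (map h (upTo n)) ≡ ∑ n h
  sum-map-upTo h n = go h n
    where
    go : ∀ (h : ℕ → ℤ) n {g : ℕ → ℕ} → sum (map h (applyUpTo g n)) ≡ ∑ n (h ∘ g)
    go h zero    = refl
    go h (suc n) = cong (_+_ (h _)) (go h n)

  ∑-cong : ∀ n {f g : ℕ → ℤ} → (∀ i → i ℕ.< n → f i ≡ g i) → ∑ n f ≡ ∑ n g
  ∑-cong zero    eq = refl
  ∑-cong (suc n) eq = cong₂ _+_ (eq 0 (s≤s z≤n)) (∑-cong n (λ i i<n → eq (suc i) (s≤s i<n)))

  ∑-zero : ∀ n {f : ℕ → ℤ} → (∀ i → i ℕ.< n → f i ≡ + 0) → ∑ n f ≡ + 0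
  ∑-zero zero    eq = refl
  ∑-zero (suc n) eq = cong₂ _+_ (eq 0 (s≤s z≤n)) (∑-zero n (λ i i<n → eq (suc i) (s≤s i<n)))

  ∑-+ : ∀ n (f g : ℕ → ℤ) → ∑[ i < n ] (f i + g i) ≡ ∑ n f + ∑ n g
  ∑-+ zero    f g = refl
  ∑-+ (suc n) f g = begin
    (f 0 + g 0) + ∑[ i < n ] (f (suc i) + g (suc i))  ≡⟨ cong (_+_ (f 0 + g 0)) (∑-+ n (f ∘ suc) (g ∘ suc)) ⟩
    (f 0 + g 0) + (∑ n (f ∘ suc) + ∑ n (g ∘ suc))    ≡⟨ interchange (f 0) (g 0) _ _ ⟩
    (f 0 + ∑ n (f ∘ suc)) + (g 0 + ∑ n (g ∘ suc))    ∎

  ∑-*ˡ : ∀ n c (f : ℕ → ℤ) → ∑[ i < n ] (c * f i) ≡ c * ∑ n f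
  ∑-*ˡ zero    c f = sym (*-zeroʳ c)
  ∑-*ˡ (suc n) c f = trans (cong (_+_ (c * f 0)) (∑-*ˡ n c (f ∘ suc))) (sym (*-distribˡ-+ c (f 0) _))

  ∑-*ʳ : ∀ n c (f : ℕ → ℤ) → ∑[ i < n ] (f i * c) ≡ ∑ n f * c
  ∑-*ʳ n c f = begin
    ∑[ i < n ] (f i * c)  ≡⟨ ∑-cong n (λ i _ → *-comm (f i) c) ⟩
    ∑[ i < n ] (c * f i)  ≡⟨ ∑-*ˡ n c f ⟩
    c * ∑ n f             ≡⟨ *-comm c _ ⟩
    ∑ n f * c             ∎

  ∑-last : ∀ n (f : ℕ → ℤ) → ∑ (suc n) f ≡ ∑ n f + f n
  ∑-last zero    f = trans (+-identityʳ (f 0)) (sym (+-identityˡ (f 0)))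
  ∑-last (suc n) f = trans (cong (_+_ (f 0)) (∑-last n (f ∘ suc))) (sym (+-assoc (f 0) _ _))

  ∑-reverse : ∀ n (f : ℕ → ℤ) → ∑ (suc n) f ≡ ∑[ k < suc n ] f (n ∸ k)
  ∑-reverse zero    f = refl
  ∑-reverse (suc n) f = begin
    f 0 + ∑ (suc n) (f ∘ suc)                       ≡⟨ cong (_+_ (f 0)) (∑-reverse n (f ∘ suc)) ⟩
    f 0 + ∑[ k < suc n ] f (suc (n ∸ k))            ≡⟨ +-comm (f 0) _ ⟩
    ∑[ k < suc n ] f (suc (n ∸ k)) + f 0            ≡⟨ cong₂ _+_ (∑-cong (suc n) λ k k≤n →
                                                                      cong f (sym (ℕₚ.+-∸-assoc 1 (ℕₚ.≤-pred k≤n))))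
                                                                (cong f (sym (ℕₚ.n∸n≡0 n))) ⟩
    ∑[ k < suc n ] f (suc n ∸ k) + f (n ∸ n)        ≡⟨ sym (∑-last (suc n) (λ k → f (suc n ∸ k))) ⟩
    ∑[ k < suc (suc n) ] f (suc n ∸ k)              ∎

  ∑-extend : ∀ N n (f : ℕ → ℤ) → n ℕ.≤ N → (∀ i → n ℕ.≤ i → f i ≡ + 0) → ∑ N f ≡ ∑ n f
  ∑-extend N n f n≤N vanish with ℕₚ.m≤n⇒m<n∨m≡n n≤N
  ... | inj₂ refl = refl
  ∑-extend (suc N) n f _ vanish | inj₁ (s≤s n≤N) = begin
    ∑ (suc N) f      ≡⟨ ∑-last N f ⟩
    ∑ N f + f N      ≡⟨ cong₂ _+_ (∑-extend N n f n≤N vanish) (vanish N n≤N) ⟩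
    ∑ n f + + 0      ≡⟨ +-identityʳ _ ⟩
    ∑ n f            ∎

  ∑-single : ∀ n j c (u : ℕ → ℤ) → ∑[ k < n ] (if k ≡ᵇ j then c else + 0) * u k ≡ (if suc j ≤ᵇ n then c * u j else + 0)
  ∑-single zero    j       c u = refl
  ∑-single (suc n) zero    c u = trans (cong (_+_ (c * u 0)) (∑-zero n (λ i _ → *-zeroˡ (u (suc i))))) (+-identityʳ _)
  ∑-single (suc n) (suc j) c u = trans (cong (_+ ∑[ k < n ] (if suc k ≡ᵇ suc j then c else + 0) * u (suc k)) (*-zeroˡ (u 0)))
                                       (trans (+-identityˡ _) (∑-single n j c (u ∘ suc)))

  ∑-triangle : ∀ n (A : ℕ → ℕ → ℤ) →
    ∑[ k < suc n ] ∑[ j < suc k ] A j k ≡ ∑[ j < suc n ] ∑[ i < suc (n ∸ j) ] A j (j ℕ.+ i)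
  ∑-triangle zero    A = refl
  ∑-triangle (suc n) A = begin
    ∑[ k < suc (suc n) ] ∑[ j < suc k ] A j k
      ≡⟨ ∑-last (suc n) (λ k → ∑[ j < suc k ] A j k) ⟩
    ∑[ k < suc n ] ∑[ j < suc k ] A j k + ∑[ j < suc (suc n) ] A j (suc n)
      ≡⟨ cong₂ _+_ (∑-triangle n A) (∑-last (suc n) (λ j → A j (suc n))) ⟩
    ∑[ j < suc n ] R n j + (∑[ j < suc n ] A j (suc n) + A (suc n) (suc n))
      ≡⟨ sym (+-assoc (∑[ j < suc n ] R n j) _ _) ⟩
    (∑[ j < suc n ] R n j + ∑[ j < suc n ] A j (suc n)) + A (suc n) (suc n)
      ≡⟨ cong₂ _+_ (sym (∑-+ (suc n) (R n) (λ j → A j (suc n)))) R-diagonal ⟩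
    ∑[ j < suc n ] (R n j + A j (suc n)) + R (suc n) (suc n)
      ≡⟨ cong (_+ R (suc n) (suc n)) (∑-cong (suc n) λ j j≤n → R-suc (ℕₚ.≤-pred j≤n)) ⟩
    ∑[ j < suc n ] R (suc n) j + R (suc n) (suc n)
      ≡⟨ sym (∑-last (suc n) (R (suc n))) ⟩
    ∑[ j < suc (suc n) ] R (suc n) j
      ∎
    where
    R : ℕ → ℕ → ℤ
    R n j = ∑[ i < suc (n ∸ j) ] A j (j ℕ.+ i)
    R-diagonal : A (suc n) (suc n) ≡ R (suc n) (suc n)
    R-diagonal = begin
      A (suc n) (suc n)                ≡⟨ cong (A (suc n)) (sym (ℕₚ.+-identityʳ (suc n))) ⟩
      A (suc n) (suc n ℕ.+ 0)          ≡⟨ sym (+-identityʳ _) ⟩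
      R′ 0                             ≡⟨ cong R′ (sym (ℕₚ.n∸n≡0 n)) ⟩
      R′ (n ∸ n)                       ∎
      where R′ = λ t → ∑[ i < suc t ] A (suc n) (suc n ℕ.+ i)
    R-suc : ∀ {n j} → j ℕ.≤ n → R n j + A j (suc n) ≡ R (suc n) j
    R-suc {n} {j} j≤n = begin
      R n j + A j (suc n)
        ≡⟨ cong (λ t → R n j + A j t) (sym (trans (ℕₚ.+-suc j (n ∸ j)) (cong suc (ℕₚ.m+[n∸m]≡n j≤n)))) ⟩
      R n j + A j (j ℕ.+ suc (n ∸ j))
        ≡⟨ sym (∑-last (suc (n ∸ j)) (λ i → A j (j ℕ.+ i))) ⟩
      ∑[ i < suc (suc (n ∸ j)) ] A j (j ℕ.+ i)
        ≡⟨ cong (λ t → ∑[ i < suc t ] A j (j ℕ.+ i)) (sym (ℕₚ.+-∸-assoc 1 j≤n)) ⟩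
      R (suc n) j
        ∎

  one : Series
  one n = if n ≡ᵇ 0 then + 1 else + 0

  infixl 6 _⊕_
  _⊕_ : Series → Series → Series
  (f ⊕ g) n = f n + g n

  infixr 8 q^_·_
  q^_·_ : ℕ → Series → Series
  (q^ e · g) n = if e ≤ᵇ n then g (n ∸ e) else + 0

  ⊛-def : ∀ f g n → (f ⊛ g) n ≡ ∑[ k < suc n ] f k * g (n ∸ k)
  ⊛-def f g n = sum-map-upTo (λ k → f k * g (n ∸ k)) (suc n)

  ⊛-at-0 : ∀ f g → (f ⊛ g) 0 ≡ f 0 * g 0
  ⊛-at-0 f g = +-identityʳ _

  ⊛-comm : ∀ f g → f ⊛ g ≗ g ⊛ f
  ⊛-comm f g n = begin
    (f ⊛ g) n                                      ≡⟨ ⊛-def f g n ⟩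
    ∑[ k < suc n ] f k * g (n ∸ k)                 ≡⟨ ∑-reverse n (λ k → f k * g (n ∸ k)) ⟩
    ∑[ k < suc n ] f (n ∸ k) * g (n ∸ (n ∸ k))     ≡⟨ ∑-cong (suc n) (λ k k≤n →
                                                        trans (*-comm (f (n ∸ k)) (g (n ∸ (n ∸ k))))
                                                              (cong (λ t → g t * f (n ∸ k)) (ℕₚ.m∸[m∸n]≡n (ℕₚ.≤-pred k≤n)))) ⟩
    ∑[ k < suc n ] g k * f (n ∸ k)                 ≡⟨ sym (⊛-def g f n) ⟩
    (g ⊛ f) n                                      ∎

  ⊛-congˡ : ∀ {f f′} g → f ≗ f′ → f ⊛ g ≗ f′ ⊛ g
  ⊛-congˡ {f} {f′} g eq n = begin
    (f ⊛ g) n                        ≡⟨ ⊛-def f g n ⟩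
    ∑[ k < suc n ] f k * g (n ∸ k)   ≡⟨ ∑-cong (suc n) (λ k _ → cong (_* g (n ∸ k)) (eq k)) ⟩
    ∑[ k < suc n ] f′ k * g (n ∸ k)  ≡⟨ sym (⊛-def f′ g n) ⟩
    (f′ ⊛ g) n                       ∎

  ⊛-congʳ : ∀ f {g g′} → g ≗ g′ → f ⊛ g ≗ f ⊛ g′
  ⊛-congʳ f {g} {g′} eq n = begin
    (f ⊛ g) n   ≡⟨ ⊛-comm f g n ⟩
    (g ⊛ f) n   ≡⟨ ⊛-congˡ f eq n ⟩
    (g′ ⊛ f) n  ≡⟨ ⊛-comm g′ f n ⟩
    (f ⊛ g′) n  ∎

  ⊛-assoc : ∀ f g h → (f ⊛ g) ⊛ h ≗ f ⊛ (g ⊛ h)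
  ⊛-assoc f g h n = begin
    ((f ⊛ g) ⊛ h) n
      ≡⟨ ⊛-def (f ⊛ g) h n ⟩
    ∑[ k < suc n ] (f ⊛ g) k * h (n ∸ k)
      ≡⟨ ∑-cong (suc n) (λ k _ → trans (cong (_* h (n ∸ k)) (⊛-def f g k))
                                       (sym (∑-*ʳ (suc k) (h (n ∸ k)) (λ j → f j * g (k ∸ j))))) ⟩
    ∑[ k < suc n ] ∑[ j < suc k ] f j * g (k ∸ j) * h (n ∸ k)
      ≡⟨ ∑-triangle n (λ j k → f j * g (k ∸ j) * h (n ∸ k)) ⟩
    ∑[ j < suc n ] ∑[ i < suc (n ∸ j) ] f j * g (j ℕ.+ i ∸ j) * h (n ∸ (j ℕ.+ i))
      ≡⟨ ∑-cong (suc n) (λ j _ → trans (∑-cong (suc (n ∸ j)) (λ i _ → reindex j i))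
                                       (∑-*ˡ (suc (n ∸ j)) (f j) (λ i → g i * h (n ∸ j ∸ i)))) ⟩
    ∑[ j < suc n ] f j * (∑[ i < suc (n ∸ j) ] g i * h (n ∸ j ∸ i))
      ≡⟨ ∑-cong (suc n) (λ j _ → cong (f j *_) (sym (⊛-def g h (n ∸ j)))) ⟩
    ∑[ j < suc n ] f j * (g ⊛ h) (n ∸ j)
      ≡⟨ sym (⊛-def f (g ⊛ h) n) ⟩
    (f ⊛ (g ⊛ h)) n
      ∎
    where
    reindex : ∀ j i → f j * g (j ℕ.+ i ∸ j) * h (n ∸ (j ℕ.+ i)) ≡ f j * (g i * h (n ∸ j ∸ i))
    reindex j i = trans (*-assoc (f j) _ _)
      (cong₂ (λ a b → f j * (g a * h b)) (ℕₚ.m+n∸m≡n j i) (sym (ℕₚ.∸-+-assoc n j i)))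

  ⊛-identityˡ : ∀ g → one ⊛ g ≗ g
  ⊛-identityˡ g n = begin
    (one ⊛ g) n                                  ≡⟨ ⊛-def one g n ⟩
    + 1 * g n + ∑[ k < n ] + 0 * g (n ∸ suc k)   ≡⟨ cong₂ _+_ (*-identityˡ (g n)) (∑-zero n (λ _ _ → refl)) ⟩
    g n + + 0                                    ≡⟨ +-identityʳ (g n) ⟩
    g n                                          ∎

  ⊛-identityʳ : ∀ g → g ⊛ one ≗ g
  ⊛-identityʳ g n = trans (⊛-comm g one n) (⊛-identityˡ g n)

  descending : Series → ℕ → List ℤ
  descending g zero    = g 0 ∷ []
  descending g (suc n) = g (suc n) ∷ descending g n

  invTab≡descending : ∀ f n → invTab f n ≡ descending (inv f) n
  invTab≡descending f zero    = refl
  invTab≡descending f (suc n) = cong (inv f (suc n) ∷_) (invTab≡descending f n)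

  sum-zipWith-descending : ∀ (F : ℕ → ℤ → ℤ) (h : ℕ → ℕ) g n →
    sum (zipWith F (applyUpTo h (suc n)) (descending g n)) ≡ ∑[ j < suc n ] F (h j) (g (n ∸ j))
  sum-zipWith-descending F h g zero    = refl
  sum-zipWith-descending F h g (suc n) = cong (_+_ (F (h 0) (g (suc n)))) (sum-zipWith-descending F (h ∘ suc) g n)

  inv-suc : ∀ f n → inv f (suc n) ≡ - (∑[ j < suc n ] f (suc j) * inv f (n ∸ j))
  inv-suc f n = cong -_ (begin
    sum (zipWith (λ j g → f (suc j) * g) (upTo (suc n)) (invTab f n))
      ≡⟨ cong (λ t → sum (zipWith (λ j g → f (suc j) * g) (upTo (suc n)) t)) (invTab≡descending f n) ⟩
    sum (zipWith (λ j g → f (suc j) * g) (upTo (suc n)) (descending (inv f) n))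
      ≡⟨ sum-zipWith-descending (λ j g → f (suc j) * g) (λ j → j) (inv f) n ⟩
    ∑[ j < suc n ] f (suc j) * inv f (n ∸ j)
      ∎)

  inv-inverseʳ : ∀ f → f 0 ≡ + 1 → f ⊛ inv f ≗ one
  inv-inverseʳ f f0≡1 zero    = trans (⊛-at-0 f (inv f)) (cong (_* + 1) f0≡1)
  inv-inverseʳ f f0≡1 (suc n) = begin
    (f ⊛ inv f) (suc n)       ≡⟨ ⊛-def f (inv f) (suc n) ⟩
    f 0 * inv f (suc n) + S   ≡⟨ cong₂ (λ a b → a * b + S) f0≡1 (inv-suc f n) ⟩
    + 1 * - S + S             ≡⟨ cong (_+ S) (*-identityˡ (- S)) ⟩
    - S + S                   ≡⟨ +-inverseˡ S ⟩
    + 0                       ∎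
    where S = ∑[ j < suc n ] f (suc j) * inv f (n ∸ j)

  inv-unique : ∀ f g → f 0 ≡ + 1 → f ⊛ g ≗ one → inv f ≗ g
  inv-unique f g f0≡1 fg≗1 n = begin
    inv f n                  ≡⟨ sym (⊛-identityʳ (inv f) n) ⟩
    (inv f ⊛ one) n          ≡⟨ ⊛-congʳ (inv f) (λ k → sym (fg≗1 k)) n ⟩
    (inv f ⊛ (f ⊛ g)) n      ≡⟨ sym (⊛-assoc (inv f) f g n) ⟩
    ((inv f ⊛ f) ⊛ g) n      ≡⟨ ⊛-congˡ g (λ k → trans (⊛-comm (inv f) f k) (inv-inverseʳ f f0≡1 k)) n ⟩
    (one ⊛ g) n              ≡⟨ ⊛-identityˡ g n ⟩
    g n                      ∎

  inv-cong : ∀ {f f′} → f 0 ≡ + 1 → f ≗ f′ → inv f ≗ inv f′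
  inv-cong {f} {f′} f0≡1 f≗f′ n = sym (inv-unique f′ (inv f) (trans (sym (f≗f′ 0)) f0≡1)
    (λ k → trans (⊛-congˡ (inv f) (λ i → sym (f≗f′ i)) k) (inv-inverseʳ f f0≡1 k)) n)

  q^-cong : ∀ e {f g} → f ≗ g → q^ e · f ≗ q^ e · g
  q^-cong e f≗g n with e ≤ᵇ n
  ... | true  = f≗g (n ∸ e)
  ... | false = refl

  q^-⊕ : ∀ e f g → q^ e · (f ⊕ g) ≗ q^ e · f ⊕ q^ e · g
  q^-⊕ e f g n with e ≤ᵇ n
  ... | true  = refl
  ... | false = refl

  q^-zero : ∀ e → q^ e · (λ _ → + 0) ≗ λ _ → + 0
  q^-zero e n = if-eta (e ≤ᵇ n)

  q^-∑ : ∀ e N (f : ℕ → Series) → q^ e · (λ n → ∑[ i < N ] f i n) ≗ λ n → ∑[ i < N ] (q^ e · f i) n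
  q^-∑ e N f n with e ≤ᵇ n
  ... | true  = refl
  ... | false = sym (∑-zero N (λ _ _ → refl))

  q^-+ : ∀ d e f → q^ (d ℕ.+ e) · f ≗ q^ d · q^ e · f
  q^-+ d e f n with d ≤ᵇ n | ℕₚ.≤ᵇ-reflects-≤ d n
  ... | false | ofⁿ d≰n rewrite ≤ᵇ-false {d ℕ.+ e} (ℕₚ.<-≤-trans (ℕₚ.≰⇒> d≰n) (ℕₚ.m≤m+n d e)) = refl
  ... | true  | ofʸ d≤n with e ≤ᵇ (n ∸ d) | ℕₚ.≤ᵇ-reflects-≤ e (n ∸ d)
  ...   | true  | ofʸ e≤n-d
    rewrite ≤ᵇ-true {d ℕ.+ e} (subst (d ℕ.+ e ℕ.≤_) (ℕₚ.m+[n∸m]≡n d≤n) (ℕₚ.+-monoʳ-≤ d e≤n-d)) =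
    cong f (sym (ℕₚ.∸-+-assoc n d e))
  ...   | false | ofⁿ e≰n-d
    rewrite ≤ᵇ-false {d ℕ.+ e} (subst (ℕ._< d ℕ.+ e) (ℕₚ.m+[n∸m]≡n d≤n) (ℕₚ.+-monoʳ-< d (ℕₚ.≰⇒> e≰n-d))) = refl

  oneMinusQ-⊛ : ∀ j h n → (oneMinusQ (suc j) ⊛ h) n ≡ h n - (q^ suc j · h) n
  oneMinusQ-⊛ j h n = begin
    (oneMinusQ (suc j) ⊛ h) n
      ≡⟨ ⊛-def (oneMinusQ (suc j)) h n ⟩
    + 1 * h n + ∑[ k < n ] (if k ≡ᵇ j then - + 1 else + 0) * h (n ∸ suc k)
      ≡⟨ cong₂ _+_ (*-identityˡ (h n)) (∑-single n j (- + 1) (λ k → h (n ∸ suc k))) ⟩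
    h n + (if suc j ≤ᵇ n then - + 1 * h (n ∸ suc j) else + 0)
      ≡⟨ cong (_+_ (h n)) (negate-if (suc j ≤ᵇ n)) ⟩
    h n - (q^ suc j · h) n
      ∎
    where
    negate-if : ∀ b → (if b then - + 1 * h (n ∸ suc j) else + 0) ≡ - (if b then h (n ∸ suc j) else + 0)
    negate-if true  = -1*i≡-i (h (n ∸ suc j))
    negate-if false = refl

  poch-at-0 : ∀ k → poch k 0 ≡ + 1
  poch-at-0 zero    = refl
  poch-at-0 (suc k) = trans (⊛-at-0 (poch k) (oneMinusQ (suc k))) (cong (_* + 1) (poch-at-0 k))

  poch-⊛-at-0 : ∀ k B → B 0 ≡ + 1 → (poch k ⊛ B) 0 ≡ + 1
  poch-⊛-at-0 k B B0≡1 = trans (⊛-at-0 (poch k) B) (cong₂ _*_ (poch-at-0 k) B0≡1)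

  inv-poch-suc : ∀ k B → B 0 ≡ + 1 → inv (poch (suc k) ⊛ B) ≗ inv (poch k ⊛ B) ⊕ q^ suc k · inv (poch (suc k) ⊛ B)
  inv-poch-suc k B B0≡1 n = begin
    X n                                  ≡⟨ sym (+-identityʳ (X n)) ⟩
    X n + + 0                            ≡⟨ cong (_+_ (X n)) (sym (+-inverseˡ R)) ⟩
    X n + (- R + R)                      ≡⟨ sym (+-assoc (X n) (- R) R) ⟩
    (X n - R) + R                        ≡⟨ cong (_+ R) (sym (oneMinusQ-⊛ k X n)) ⟩
    (oneMinusQ (suc k) ⊛ X) n + R        ≡⟨ cong (_+ R) (sym (inv-unique (poch k ⊛ B) (oneMinusQ (suc k) ⊛ X)
                                              (poch-⊛-at-0 k B B0≡1) inverse n)) ⟩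
    inv (poch k ⊛ B) n + R               ∎
    where
    X = inv (poch (suc k) ⊛ B)
    R = (q^ suc k · X) n
    o = oneMinusQ (suc k)
    inverse : (poch k ⊛ B) ⊛ (o ⊛ X) ≗ one
    inverse i = begin
      ((poch k ⊛ B) ⊛ (o ⊛ X)) i   ≡⟨ ⊛-assoc (poch k) B (o ⊛ X) i ⟩
      (poch k ⊛ (B ⊛ (o ⊛ X))) i   ≡⟨ ⊛-congʳ (poch k) (λ i → sym (⊛-assoc B o X i)) i ⟩
      (poch k ⊛ ((B ⊛ o) ⊛ X)) i   ≡⟨ ⊛-congʳ (poch k) (⊛-congˡ X (⊛-comm B o)) i ⟩
      (poch k ⊛ ((o ⊛ B) ⊛ X)) i   ≡⟨ ⊛-congʳ (poch k) (⊛-assoc o B X) i ⟩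
      (poch k ⊛ (o ⊛ (B ⊛ X))) i   ≡⟨ sym (⊛-assoc (poch k) o (B ⊛ X) i) ⟩
      (poch (suc k) ⊛ (B ⊛ X)) i   ≡⟨ sym (⊛-assoc (poch (suc k)) B X i) ⟩
      ((poch (suc k) ⊛ B) ⊛ X) i   ≡⟨ inv-inverseʳ (poch (suc k) ⊛ B) (poch-⊛-at-0 (suc k) B B0≡1) i ⟩
      one i                        ∎

  invPoch : ℕ → ℕ → ℕ → Series
  invPoch i j k = inv (poch i ⊛ poch j ⊛ poch k)

  poch³-at-0 : ∀ i j k → (poch i ⊛ poch j ⊛ poch k) 0 ≡ + 1
  poch³-at-0 i j k = trans (⊛-at-0 (poch i ⊛ poch j) (poch k)) (cong₂ _*_ (poch-⊛-at-0 i (poch j) (poch-at-0 j)) (poch-at-0 k))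

  inv-poch-suc-along : ∀ (G : ℕ → Series) k B → B 0 ≡ + 1 → (∀ x → G x ≗ inv (poch x ⊛ B)) →
    G (suc k) ≗ G k ⊕ q^ suc k · G (suc k)
  inv-poch-suc-along G k B B0≡1 G≗ n = begin
    G (suc k) n                                                      ≡⟨ G≗ (suc k) n ⟩
    inv (poch (suc k) ⊛ B) n                                         ≡⟨ inv-poch-suc k B B0≡1 n ⟩
    inv (poch k ⊛ B) n + (q^ suc k · inv (poch (suc k) ⊛ B)) n      ≡⟨ cong₂ _+_ (sym (G≗ k n))
                                                                         (q^-cong (suc k) (λ i → sym (G≗ (suc k) i)) n) ⟩
    G k n + (q^ suc k · G (suc k)) n                                 ∎

  invPoch-suc₁ : ∀ i j k → invPoch (suc i) j k ≗ invPoch i j k ⊕ q^ suc i · invPoch (suc i) j k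
  invPoch-suc₁ i j k = inv-poch-suc-along (λ x → invPoch x j k) i (poch j ⊛ poch k) (poch-⊛-at-0 j (poch k) (poch-at-0 k))
    (λ x → inv-cong (poch³-at-0 x j k) (⊛-assoc (poch x) (poch j) (poch k)))

  invPoch-suc₂ : ∀ i j k → invPoch i (suc j) k ≗ invPoch i j k ⊕ q^ suc j · invPoch i (suc j) k
  invPoch-suc₂ i j k = inv-poch-suc-along (λ x → invPoch i x k) j (poch i ⊛ poch k) (poch-⊛-at-0 i (poch k) (poch-at-0 k))
    (λ x → inv-cong (poch³-at-0 i x k) (λ n → trans (⊛-congˡ (poch k) (⊛-comm (poch i) (poch x)) n)
                                                    (⊛-assoc (poch x) (poch i) (poch k) n)))

  invPoch-suc₃ : ∀ i j k → invPoch i j (suc k) ≗ invPoch i j k ⊕ q^ suc k · invPoch i j (suc k)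
  invPoch-suc₃ i j k = inv-poch-suc-along (λ x → invPoch i j x) k (poch i ⊛ poch j) (poch-⊛-at-0 i (poch j) (poch-at-0 j))
    (λ x → inv-cong (poch³-at-0 i j x) (⊛-comm (poch i ⊛ poch j) (poch x)))

  invPoch-000 : invPoch 0 0 0 ≗ one
  invPoch-000 = inv-unique (poch 0 ⊛ poch 0 ⊛ poch 0) one refl
    (λ n → trans (⊛-identityʳ (one ⊛ one ⊛ one) n) (trans (⊛-congˡ one (⊛-identityˡ one) n) (⊛-identityˡ one n)))

  -- X m n is the coefficient of z^m q^n.
  Series₂ : Set
  Series₂ = ℕ → ℕ → ℤ

  infix 4 _≗₂_
  _≗₂_ : Series₂ → Series₂ → Set
  X ≗₂ Y = ∀ m n → X m n ≡ Y m n

  infixl 6 _⊕₂_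
  _⊕₂_ : Series₂ → Series₂ → Series₂
  (X ⊕₂ Y) m n = X m n + Y m n

  infixr 8 z^_⊙_
  z^_⊙_ : ℕ → Series₂ → Series₂
  (z^ k ⊙ X) m n = (q^ k · λ m′ → X m′ n) m

  infixr 8 q^_⊙_
  q^_⊙_ : ℕ → Series₂ → Series₂
  (q^ l ⊙ X) m = q^ l · X m

  infixl 9 _[z≔zq]
  _[z≔zq] : Series₂ → Series₂
  (X [z≔zq]) m = q^ m · X m

  z^-cong : ∀ k {X Y} → X ≗₂ Y → z^ k ⊙ X ≗₂ z^ k ⊙ Y
  z^-cong k X≗Y m n = q^-cong k (λ m′ → X≗Y m′ n) m

  z^-⊕ : ∀ k X Y → z^ k ⊙ (X ⊕₂ Y) ≗₂ z^ k ⊙ X ⊕₂ z^ k ⊙ Y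
  z^-⊕ k X Y m n = q^-⊕ k (λ m′ → X m′ n) (λ m′ → Y m′ n) m

  z^-+ : ∀ k k′ X → z^ (k ℕ.+ k′) ⊙ X ≗₂ z^ k ⊙ z^ k′ ⊙ X
  z^-+ k k′ X m n = q^-+ k k′ (λ m′ → X m′ n) m

  q^⊙-cong : ∀ l {X Y} → X ≗₂ Y → q^ l ⊙ X ≗₂ q^ l ⊙ Y
  q^⊙-cong l X≗Y m = q^-cong l (X≗Y m)

  q^⊙-⊕ : ∀ l X Y → q^ l ⊙ (X ⊕₂ Y) ≗₂ q^ l ⊙ X ⊕₂ q^ l ⊙ Y
  q^⊙-⊕ l X Y m = q^-⊕ l (X m) (Y m)

  q^⊙-+ : ∀ l l′ X → q^ (l ℕ.+ l′) ⊙ X ≗₂ q^ l ⊙ q^ l′ ⊙ X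
  q^⊙-+ l l′ X m = q^-+ l l′ (X m)

  q^⊙-z^ : ∀ l k X → q^ l ⊙ z^ k ⊙ X ≗₂ z^ k ⊙ q^ l ⊙ X
  q^⊙-z^ l k X m n with k ≤ᵇ m
  ... | true  = refl
  ... | false = q^-zero l n

  z^q^-[z≔zq] : ∀ k l X → (z^ k ⊙ q^ l ⊙ X) [z≔zq] ≗₂ z^ k ⊙ q^ (l ℕ.+ k) ⊙ X [z≔zq]
  z^q^-[z≔zq] k l X m n with k ≤ᵇ m | ℕₚ.≤ᵇ-reflects-≤ k m
  ... | false | _       = q^-zero m n
  ... | true  | ofʸ k≤m = begin
    (q^ m · q^ l · X (m ∸ k)) n                    ≡⟨ sym (q^-+ m l (X (m ∸ k)) n) ⟩
    (q^ (m ℕ.+ l) · X (m ∸ k)) n                   ≡⟨ cong (λ e → (q^ e · X (m ∸ k)) n) exponents ⟩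
    (q^ (l ℕ.+ k ℕ.+ (m ∸ k)) · X (m ∸ k)) n       ≡⟨ q^-+ (l ℕ.+ k) (m ∸ k) (X (m ∸ k)) n ⟩
    (q^ (l ℕ.+ k) · q^ (m ∸ k) · X (m ∸ k)) n      ∎
    where
    exponents : m ℕ.+ l ≡ l ℕ.+ k ℕ.+ (m ∸ k)
    exponents = trans (ℕₚ.+-comm m l) (trans (cong (l ℕ.+_) (sym (ℕₚ.m+[n∸m]≡n k≤m))) (sym (ℕₚ.+-assoc l k (m ∸ k))))

  weight : ℕ → ℕ → ℕ → ℕ
  weight i j k = i ℕ.+ 2 ℕ.* j ℕ.+ 3 ℕ.* k

  weight-suc₂ : ∀ i j k → weight i (suc j) k ≡ 2 ℕ.+ weight i j k
  weight-suc₂ i j k = solve 3 (λ i j k → i :+ con 2 :* (con 1 :+ j) :+ con 3 :* k := con 2 :+ (i :+ con 2 :* j :+ con 3 :* k)) refl i j k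

  weight-suc₃ : ∀ i j k → weight i j (suc k) ≡ 3 ℕ.+ weight i j k
  weight-suc₃ i j k = solve 3 (λ i j k → i :+ con 2 :* j :+ con 3 :* (con 1 :+ k) := con 3 :+ (i :+ con 2 :* j :+ con 3 :* k)) refl i j k

  ≤-weight₁ : ∀ i j k → i ℕ.≤ weight i j k
  ≤-weight₁ i j k = ℕₚ.≤-trans (ℕₚ.m≤m+n i (2 ℕ.* j)) (ℕₚ.m≤m+n (i ℕ.+ 2 ℕ.* j) (3 ℕ.* k))

  ≤-weight₂ : ∀ i j k → j ℕ.≤ weight i j k
  ≤-weight₂ i j k = ℕₚ.≤-trans (ℕₚ.m≤m+n j (j ℕ.+ 0))
                   (ℕₚ.≤-trans (ℕₚ.m≤n+m (2 ℕ.* j) i) (ℕₚ.m≤m+n (i ℕ.+ 2 ℕ.* j) (3 ℕ.* k)))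

  ≤-weight₃ : ∀ i j k → k ℕ.≤ weight i j k
  ≤-weight₃ i j k = ℕₚ.≤-trans (ℕₚ.m≤m+n k (k ℕ.+ (k ℕ.+ 0))) (ℕₚ.m≤n+m (3 ℕ.* k) (i ℕ.+ 2 ℕ.* j))

  Family : Set
  Family = ℕ → ℕ → ℕ → Series

  box : ℕ → ℕ → ℕ → (ℕ → ℕ → ℕ → ℤ) → ℤ
  box N₁ N₂ N₃ f = ∑[ i < N₁ ] ∑[ j < N₂ ] ∑[ k < N₃ ] f i j k

  zTerm : Family → ℕ → ℕ → ℕ → ℕ → ℕ → ℤ
  zTerm s m n i j k = if weight i j k ≡ᵇ m then s i j k n else + 0

  -- coefficient of z^m q^n in Σ_{i,j,k} z^{weight i j k} s i j k; indices above m have weight above m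
  zSeries : Family → Series₂
  zSeries s m n = box (suc m) (suc m) (suc m) (zTerm s m n)

  box-zero : ∀ N₁ N₂ N₃ {f} → (∀ i j k → f i j k ≡ + 0) → box N₁ N₂ N₃ f ≡ + 0
  box-zero N₁ N₂ N₃ f≡0 = ∑-zero N₁ λ i _ → ∑-zero N₂ λ j _ → ∑-zero N₃ λ k _ → f≡0 i j k

  box-+ : ∀ N₁ N₂ N₃ f g → box N₁ N₂ N₃ (λ i j k → f i j k + g i j k) ≡ box N₁ N₂ N₃ f + box N₁ N₂ N₃ g
  box-+ N₁ N₂ N₃ f g = begin
    ∑[ i < N₁ ] ∑[ j < N₂ ] ∑[ k < N₃ ] (f i j k + g i j k)
      ≡⟨ ∑-cong N₁ (λ i _ → ∑-cong N₂ λ j _ → ∑-+ N₃ (f i j) (g i j)) ⟩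
    ∑[ i < N₁ ] ∑[ j < N₂ ] (∑[ k < N₃ ] f i j k + ∑[ k < N₃ ] g i j k)
      ≡⟨ ∑-cong N₁ (λ i _ → ∑-+ N₂ _ _) ⟩
    ∑[ i < N₁ ] (∑[ j < N₂ ] ∑[ k < N₃ ] f i j k + ∑[ j < N₂ ] ∑[ k < N₃ ] g i j k)
      ≡⟨ ∑-+ N₁ _ _ ⟩
    box N₁ N₂ N₃ f + box N₁ N₂ N₃ g
      ∎

  q^-box : ∀ l N₁ N₂ N₃ (F : ℕ → ℕ → ℕ → Series) →
    q^ l · (λ n → box N₁ N₂ N₃ (λ i j k → F i j k n)) ≗ λ n → box N₁ N₂ N₃ (λ i j k → (q^ l · F i j k) n)
  q^-box l N₁ N₂ N₃ F n = begin
    (q^ l · (λ n → ∑[ i < N₁ ] ∑[ j < N₂ ] ∑[ k < N₃ ] F i j k n)) n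
      ≡⟨ q^-∑ l N₁ (λ i n → ∑[ j < N₂ ] ∑[ k < N₃ ] F i j k n) n ⟩
    ∑[ i < N₁ ] (q^ l · (λ n → ∑[ j < N₂ ] ∑[ k < N₃ ] F i j k n)) n
      ≡⟨ ∑-cong N₁ (λ i _ → q^-∑ l N₂ (λ j n → ∑[ k < N₃ ] F i j k n) n) ⟩
    ∑[ i < N₁ ] ∑[ j < N₂ ] (q^ l · (λ n → ∑[ k < N₃ ] F i j k n)) n
      ≡⟨ ∑-cong N₁ (λ i _ → ∑-cong N₂ λ j _ → q^-∑ l N₃ (F i j) n) ⟩
    ∑[ i < N₁ ] ∑[ j < N₂ ] ∑[ k < N₃ ] (q^ l · F i j k) n
      ∎

  zTerm-beyond : ∀ s m n i j k → m ℕ.< weight i j k → zTerm s m n i j k ≡ + 0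
  zTerm-beyond s m n i j k m<w rewrite ≡ᵇ-false (ℕₚ.>⇒≢ m<w) = refl

  zSeries-box : ∀ s m n N₁ N₂ N₃ → m ℕ.< N₁ → m ℕ.< N₂ → m ℕ.< N₃ → box N₁ N₂ N₃ (zTerm s m n) ≡ zSeries s m n
  zSeries-box s m n N₁ N₂ N₃ m<N₁ m<N₂ m<N₃ = begin
    ∑[ i < N₁ ] ∑[ j < N₂ ] ∑[ k < N₃ ] t i j k
      ≡⟨ ∑-extend N₁ (suc m) _ m<N₁ (λ i m<i → ∑-zero N₂ λ j _ → ∑-zero N₃ λ k _ →
           zTerm-beyond s m n i j k (ℕₚ.<-≤-trans m<i (≤-weight₁ i j k))) ⟩
    ∑[ i < suc m ] ∑[ j < N₂ ] ∑[ k < N₃ ] t i j k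
      ≡⟨ ∑-cong (suc m) (λ i _ → ∑-extend N₂ (suc m) _ m<N₂ λ j m<j → ∑-zero N₃ λ k _ →
           zTerm-beyond s m n i j k (ℕₚ.<-≤-trans m<j (≤-weight₂ i j k))) ⟩
    ∑[ i < suc m ] ∑[ j < suc m ] ∑[ k < N₃ ] t i j k
      ≡⟨ ∑-cong (suc m) (λ i _ → ∑-cong (suc m) λ j _ → ∑-extend N₃ (suc m) _ m<N₃ λ k m<k →
           zTerm-beyond s m n i j k (ℕₚ.<-≤-trans m<k (≤-weight₃ i j k))) ⟩
    ∑[ i < suc m ] ∑[ j < suc m ] ∑[ k < suc m ] t i j k
      ∎
    where t = zTerm s m n

  zSeries-at-0 : ∀ s n → zSeries s 0 n ≡ s 0 0 0 n
  zSeries-at-0 s n = trans (+-identityʳ _) (trans (+-identityʳ _) (+-identityʳ _))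

  zSeries-⊕ : ∀ {s t u} → (∀ i j k → s i j k ≗ t i j k ⊕ u i j k) → zSeries s ≗₂ zSeries t ⊕₂ zSeries u
  zSeries-⊕ {s} {t} {u} s≗t⊕u m n = trans (∑-cong (suc m) λ i _ → ∑-cong (suc m) λ j _ → ∑-cong (suc m) λ k _ → split i j k)
                                          (box-+ (suc m) (suc m) (suc m) (zTerm t m n) (zTerm u m n))
    where
    split : ∀ i j k → zTerm s m n i j k ≡ zTerm t m n i j k + zTerm u m n i j k
    split i j k with weight i j k ≡ᵇ m
    ... | true  = s≗t⊕u i j k n
    ... | false = refl

  zSeries-q^ : ∀ l s → zSeries (λ i j k → q^ l · s i j k) ≗₂ q^ l ⊙ zSeries s
  zSeries-q^ l s m n = trans (∑-cong (suc m) λ i _ → ∑-cong (suc m) λ j _ → ∑-cong (suc m) λ k _ → commute i j k)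
                             (sym (q^-box l (suc m) (suc m) (suc m) (λ i j k n → zTerm s m n i j k) n))
    where
    commute : ∀ i j k → zTerm (λ i j k → q^ l · s i j k) m n i j k ≡ (q^ l · (λ n → zTerm s m n i j k)) n
    commute i j k with weight i j k ≡ᵇ m
    ... | true  = refl
    ... | false = sym (q^-zero l n)

  zSeries-q^weight : ∀ s → zSeries (λ i j k → q^ weight i j k · s i j k) ≗₂ zSeries s [z≔zq]
  zSeries-q^weight s m n = trans (∑-cong (suc m) λ i _ → ∑-cong (suc m) λ j _ → ∑-cong (suc m) λ k _ → on-support i j k)
                                 (zSeries-q^ m s m n)
    where
    on-support : ∀ i j k → zTerm (λ i j k → q^ weight i j k · s i j k) m n i j k ≡ zTerm (λ i j k → q^ m · s i j k) m n i j k
    on-support i j k with weight i j k ≡ᵇ m in eq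
    ... | true  = cong (λ e → (q^ e · s i j k) n) (ℕₚ.≡ᵇ⇒≡ (weight i j k) m (subst T (sym eq) _))
    ... | false = refl

  raise₁ raise₂ raise₃ : Family → Family
  raise₁ u zero    j k = λ _ → + 0
  raise₁ u (suc i) j k = u i j k
  raise₂ u i zero    k = λ _ → + 0
  raise₂ u i (suc j) k = u i j k
  raise₃ u i j zero    = λ _ → + 0
  raise₃ u i j (suc k) = u i j k

  zSeries-raise₁ : ∀ u → zSeries (raise₁ u) ≗₂ z^ 1 ⊙ zSeries u
  zSeries-raise₁ u zero    n = refl
  zSeries-raise₁ u (suc m) n = begin
    ∑[ j < suc (suc m) ] ∑[ k < suc (suc m) ] zTerm (raise₁ u) (suc m) n 0 j k + B
      ≡⟨ cong (_+ B) (∑-zero (suc (suc m)) λ j _ → ∑-zero (suc (suc m)) λ k _ → if-eta (weight 0 j k ≡ᵇ suc m)) ⟩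
    + 0 + B
      ≡⟨ +-identityˡ B ⟩
    B
      ≡⟨ zSeries-box u m n (suc m) (suc (suc m)) (suc (suc m)) ℕₚ.≤-refl (ℕₚ.n≤1+n (suc m)) (ℕₚ.n≤1+n (suc m)) ⟩
    zSeries u m n
      ∎
    where B = box (suc m) (suc (suc m)) (suc (suc m)) (zTerm u m n)

  zSeries-raise₂ : ∀ u → zSeries (raise₂ u) ≗₂ z^ 2 ⊙ zSeries u
  zSeries-raise₂ u m n = trans peel (shifted m)
    where
    t : ℕ → ℕ → ℕ → ℕ → ℤ
    t m i j k = if 2 ℕ.+ weight i j k ≡ᵇ m then u i j k n else + 0
    peel : zSeries (raise₂ u) m n ≡ box (suc m) m (suc m) (t m)
    peel = ∑-cong (suc m) λ i _ → begin
      ∑[ k < suc m ] zTerm (raise₂ u) m n i 0 k + ∑[ j < m ] ∑[ k < suc m ] zTerm (raise₂ u) m n i (suc j) k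
        ≡⟨ cong₂ _+_ (∑-zero (suc m) λ k _ → if-eta (weight i 0 k ≡ᵇ m))
                     (∑-cong m λ j _ → ∑-cong (suc m) λ k _ →
                        cong (λ w → if w ≡ᵇ m then u i j k n else + 0) (weight-suc₂ i j k)) ⟩
      + 0 + ∑[ j < m ] ∑[ k < suc m ] t m i j k
        ≡⟨ +-identityˡ _ ⟩
      ∑[ j < m ] ∑[ k < suc m ] t m i j k
        ∎
    shifted : ∀ m → box (suc m) m (suc m) (t m) ≡ (z^ 2 ⊙ zSeries u) m n
    shifted zero          = refl
    shifted (suc zero)    = box-zero 2 1 2 λ _ _ _ → refl
    shifted (suc (suc m)) = zSeries-box u m n _ _ _ (ℕₚ.m≤n+m (suc m) 2) (ℕₚ.m≤n+m (suc m) 1) (ℕₚ.m≤n+m (suc m) 2)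

  zSeries-raise₃ : ∀ u → zSeries (raise₃ u) ≗₂ z^ 3 ⊙ zSeries u
  zSeries-raise₃ u m n = trans peel (shifted m)
    where
    t : ℕ → ℕ → ℕ → ℕ → ℤ
    t m i j k = if 3 ℕ.+ weight i j k ≡ᵇ m then u i j k n else + 0
    peel : zSeries (raise₃ u) m n ≡ box (suc m) (suc m) m (t m)
    peel = ∑-cong (suc m) λ i _ → ∑-cong (suc m) λ j _ → begin
      zTerm (raise₃ u) m n i j 0 + ∑[ k < m ] zTerm (raise₃ u) m n i j (suc k)
        ≡⟨ cong₂ _+_ (if-eta (weight i j 0 ≡ᵇ m))
                     (∑-cong m λ k _ → cong (λ w → if w ≡ᵇ m then u i j k n else + 0) (weight-suc₃ i j k)) ⟩
      + 0 + ∑[ k < m ] t m i j k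
        ≡⟨ +-identityˡ _ ⟩
      ∑[ k < m ] t m i j k
        ∎
    shifted : ∀ m → box (suc m) (suc m) m (t m) ≡ (z^ 3 ⊙ zSeries u) m n
    shifted zero                = refl
    shifted (suc zero)          = box-zero 2 2 1 λ _ _ _ → refl
    shifted (suc (suc zero))    = box-zero 3 3 2 λ _ _ _ → refl
    shifted (suc (suc (suc m))) = zSeries-box u m n _ _ _ (ℕₚ.m≤n+m (suc m) 3) (ℕₚ.m≤n+m (suc m) 3) (ℕₚ.m≤n+m (suc m) 2)

  zSeries-cong : ∀ {s t} → (∀ i j k → s i j k ≗ t i j k) → zSeries s ≗₂ zSeries t
  zSeries-cong {s} {t} s≗t m n = ∑-cong (suc m) λ i _ → ∑-cong (suc m) λ j _ → ∑-cong (suc m) λ k _ → pointwise i j k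
    where
    pointwise : ∀ i j k → zTerm s m n i j k ≡ zTerm t m n i j k
    pointwise i j k = cong (λ x → if weight i j k ≡ᵇ m then x else + 0) (s≗t i j k n)

  zSeries-split : ∀ {s t u : Family} (raise : Family → Family) d l → (∀ v → zSeries (raise v) ≗₂ z^ d ⊙ zSeries v) →
    (∀ i j k → s i j k ≗ t i j k ⊕ raise (λ i j k → q^ l · u i j k) i j k) →
    zSeries s ≗₂ zSeries t ⊕₂ z^ d ⊙ q^ l ⊙ zSeries u
  zSeries-split {s} {t} {u} raise d l zSeries-raise s≗ m n = begin
    zSeries s m n                                   ≡⟨ zSeries-⊕ {s} {t} {raise v} s≗ m n ⟩
    zSeries t m n + zSeries (raise v) m n           ≡⟨ cong (_+_ (zSeries t m n)) (zSeries-raise v m n) ⟩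
    zSeries t m n + (z^ d ⊙ zSeries v) m n          ≡⟨ cong (_+_ (zSeries t m n)) (z^-cong d (zSeries-q^ l u) m n) ⟩
    zSeries t m n + (z^ d ⊙ q^ l ⊙ zSeries u) m n ∎
    where v = λ i j k → q^ l · u i j k

  C₂ : ℕ → ℕ
  C₂ zero    = 0
  C₂ (suc n) = n ℕ.+ C₂ n

  -- For a = b = c = 0 this is the exponent of the theorem (expo≡exponent).
  exponent : ℕ → ℕ → ℕ → ℕ → ℕ → ℕ → ℕ
  exponent a b c i j k = C₂ (weight i j k) ℕ.+ (C₂ (suc i) ℕ.+ C₂ (suc j) ℕ.+ a ℕ.* i ℕ.+ b ℕ.* j ℕ.+ c ℕ.* k)

  summand : ℕ → ℕ → ℕ → Family
  summand a b c i j k = q^ exponent a b c i j k · invPoch i j k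

  F : ℕ → ℕ → ℕ → Series₂
  F a b c = zSeries (summand a b c)

  -- In the solver calls W, I, J stand for C₂ (weight i j k), C₂ i, C₂ j, and each left-hand side
  -- is the definitional unfolding of the exponent on the left of the lemma.
  exponent-sucᵃ : ∀ a b c i j k → exponent (suc a) b c i j k ≡ exponent a b c i j k ℕ.+ i
  exponent-sucᵃ a b c i j k = solve 9 (λ a b c i j k W I J →
    W :+ ((i :+ I) :+ (j :+ J) :+ (con 1 :+ a) :* i :+ b :* j :+ c :* k) :=
    W :+ ((i :+ I) :+ (j :+ J) :+ a :* i :+ b :* j :+ c :* k) :+ i) refl a b c i j k (C₂ (weight i j k)) (C₂ i) (C₂ j)

  exponent-sucᵇ : ∀ a b c i j k → exponent a (suc b) c i j k ≡ exponent a b c i j k ℕ.+ j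
  exponent-sucᵇ a b c i j k = solve 9 (λ a b c i j k W I J →
    W :+ ((i :+ I) :+ (j :+ J) :+ a :* i :+ (con 1 :+ b) :* j :+ c :* k) :=
    W :+ ((i :+ I) :+ (j :+ J) :+ a :* i :+ b :* j :+ c :* k) :+ j) refl a b c i j k (C₂ (weight i j k)) (C₂ i) (C₂ j)

  exponent-sucᶜ : ∀ a b c i j k → exponent a b (suc c) i j k ≡ exponent a b c i j k ℕ.+ k
  exponent-sucᶜ a b c i j k = solve 9 (λ a b c i j k W I J →
    W :+ ((i :+ I) :+ (j :+ J) :+ a :* i :+ b :* j :+ (con 1 :+ c) :* k) :=
    W :+ ((i :+ I) :+ (j :+ J) :+ a :* i :+ b :* j :+ c :* k) :+ k) refl a b c i j k (C₂ (weight i j k)) (C₂ i) (C₂ j)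

  exponent-suc₁ : ∀ a b c i j k → exponent a b c (suc i) j k ≡ suc a ℕ.+ exponent (2 ℕ.+ a) (2 ℕ.+ b) (3 ℕ.+ c) i j k
  exponent-suc₁ a b c i j k = solve 9 (λ a b c i j k W I J →
    ((i :+ con 2 :* j :+ con 3 :* k) :+ W) :+ (((con 1 :+ i) :+ (i :+ I)) :+ (j :+ J) :+ a :* (con 1 :+ i) :+ b :* j :+ c :* k) :=
    (con 1 :+ a) :+ (W :+ ((i :+ I) :+ (j :+ J) :+ (con 2 :+ a) :* i :+ (con 2 :+ b) :* j :+ (con 3 :+ c) :* k)))
    refl a b c i j k (C₂ (weight i j k)) (C₂ i) (C₂ j)

  exponent-suc₂ : ∀ a b c i j k → exponent a b c i (suc j) k ≡ (2 ℕ.+ b) ℕ.+ exponent (2 ℕ.+ a) (5 ℕ.+ b) (6 ℕ.+ c) i j k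
  exponent-suc₂ a b c i j k = trans (cong₂ ℕ._+_ (cong C₂ (weight-suc₂ i j k)) refl) (solve 9 (λ a b c i j k W I J →
    ((con 1 :+ (i :+ con 2 :* j :+ con 3 :* k)) :+ ((i :+ con 2 :* j :+ con 3 :* k) :+ W)) :+ ((i :+ I)
      :+ ((con 1 :+ j) :+ (j :+ J)) :+ a :* i :+ b :* (con 1 :+ j) :+ c :* k) :=
    (con 2 :+ b) :+ (W :+ ((i :+ I) :+ (j :+ J) :+ (con 2 :+ a) :* i :+ (con 5 :+ b) :* j :+ (con 6 :+ c) :* k)))
    refl a b c i j k (C₂ (weight i j k)) (C₂ i) (C₂ j))

  exponent-suc₃ : ∀ a b c i j k → exponent a b c i j (suc k) ≡ (3 ℕ.+ c) ℕ.+ exponent (3 ℕ.+ a) (6 ℕ.+ b) (9 ℕ.+ c) i j k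
  exponent-suc₃ a b c i j k = trans (cong₂ ℕ._+_ (cong C₂ (weight-suc₃ i j k)) refl) (solve 9 (λ a b c i j k W I J →
    ((con 2 :+ (i :+ con 2 :* j :+ con 3 :* k)) :+ ((con 1 :+ (i :+ con 2 :* j :+ con 3 :* k)) :+ ((i :+ con 2 :* j :+ con 3 :* k) :+ W)))
      :+ ((i :+ I) :+ (j :+ J) :+ a :* i :+ b :* j :+ c :* (con 1 :+ k)) :=
    (con 3 :+ c) :+ (W :+ ((i :+ I) :+ (j :+ J) :+ (con 3 :+ a) :* i :+ (con 6 :+ b) :* j :+ (con 9 :+ c) :* k)))
    refl a b c i j k (C₂ (weight i j k)) (C₂ i) (C₂ j))

  exponent-σ : ∀ a b c i j k → exponent (suc a) (2 ℕ.+ b) (3 ℕ.+ c) i j k ≡ weight i j k ℕ.+ exponent a b c i j k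
  exponent-σ a b c i j k = solve 9 (λ a b c i j k W I J →
    W :+ ((i :+ I) :+ (j :+ J) :+ (con 1 :+ a) :* i :+ (con 2 :+ b) :* j :+ (con 3 :+ c) :* k) :=
    (i :+ con 2 :* j :+ con 3 :* k) :+ (W :+ ((i :+ I) :+ (j :+ J) :+ a :* i :+ b :* j :+ c :* k)))
    refl a b c i j k (C₂ (weight i j k)) (C₂ i) (C₂ j)

  exponent-origin : ∀ a b c → exponent a b c 0 0 0 ≡ 0
  exponent-origin a b c = solve 3 (λ a b c → con 0 :+ (con 0 :+ con 0 :+ a :* con 0 :+ b :* con 0 :+ c :* con 0) := con 0) refl a b c

  q^-split : ∀ {H H₀ : Series} {d E E₁ e E₀} → H ≗ H₀ ⊕ q^ d · H → E₁ ≡ E ℕ.+ d → E ≡ e ℕ.+ E₀ →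
    q^ E · H ≗ q^ E₁ · H ⊕ q^ e · q^ E₀ · H₀
  q^-split {H} {H₀} {d} {E} {E₁} {e} {E₀} H≗ E₁≡ E≡ n = begin
    (q^ E · H) n                                    ≡⟨ q^-cong E H≗ n ⟩
    (q^ E · (H₀ ⊕ q^ d · H)) n                      ≡⟨ q^-⊕ E H₀ (q^ d · H) n ⟩
    (q^ E · H₀) n + (q^ E · q^ d · H) n             ≡⟨ cong₂ _+_ (trans (cong (λ x → (q^ x · H₀) n) E≡) (q^-+ e E₀ H₀ n))
                                                                (trans (sym (q^-+ E d H n)) (cong (λ x → (q^ x · H) n) (sym E₁≡))) ⟩
    (q^ e · q^ E₀ · H₀) n + (q^ E₁ · H) n           ≡⟨ +-comm ((q^ e · q^ E₀ · H₀) n) ((q^ E₁ · H) n) ⟩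
    (q^ E₁ · H) n + (q^ e · q^ E₀ · H₀) n           ∎

  summand-split₁ : ∀ a b c i j k → summand a b c i j k ≗
    summand (suc a) b c i j k ⊕ raise₁ (λ i j k → q^ suc a · summand (2 ℕ.+ a) (2 ℕ.+ b) (3 ℕ.+ c) i j k) i j k
  summand-split₁ a b c zero    j k n = sym (+-identityʳ _)
  summand-split₁ a b c (suc i) j k   = q^-split {invPoch (suc i) j k} {invPoch i j k} {e = suc a}
    (invPoch-suc₁ i j k) (exponent-sucᵃ a b c (suc i) j k) (exponent-suc₁ a b c i j k)

  summand-split₂ : ∀ a b c i j k → summand a b c i j k ≗
    summand a (suc b) c i j k ⊕ raise₂ (λ i j k → q^ (2 ℕ.+ b) · summand (2 ℕ.+ a) (5 ℕ.+ b) (6 ℕ.+ c) i j k) i j k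
  summand-split₂ a b c i zero    k n = sym (+-identityʳ _)
  summand-split₂ a b c i (suc j) k   = q^-split {invPoch i (suc j) k} {invPoch i j k} {e = 2 ℕ.+ b}
    (invPoch-suc₂ i j k) (exponent-sucᵇ a b c i (suc j) k) (exponent-suc₂ a b c i j k)

  summand-split₃ : ∀ a b c i j k → summand a b c i j k ≗
    summand a b (suc c) i j k ⊕ raise₃ (λ i j k → q^ (3 ℕ.+ c) · summand (3 ℕ.+ a) (6 ℕ.+ b) (9 ℕ.+ c) i j k) i j k
  summand-split₃ a b c i j zero    n = sym (+-identityʳ _)
  summand-split₃ a b c i j (suc k)   = q^-split {invPoch i j (suc k)} {invPoch i j k} {e = 3 ℕ.+ c}
    (invPoch-suc₃ i j k) (exponent-sucᶜ a b c i j (suc k)) (exponent-suc₃ a b c i j k)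

  F-split₁ : ∀ a b c → F a b c ≗₂ F (suc a) b c ⊕₂ z^ 1 ⊙ q^ suc a ⊙ F (2 ℕ.+ a) (2 ℕ.+ b) (3 ℕ.+ c)
  F-split₁ a b c = zSeries-split {t = summand (suc a) b c} {u = summand (2 ℕ.+ a) (2 ℕ.+ b) (3 ℕ.+ c)}
    raise₁ 1 (suc a) zSeries-raise₁ (summand-split₁ a b c)

  F-split₂ : ∀ a b c → F a b c ≗₂ F a (suc b) c ⊕₂ z^ 2 ⊙ q^ (2 ℕ.+ b) ⊙ F (2 ℕ.+ a) (5 ℕ.+ b) (6 ℕ.+ c)
  F-split₂ a b c = zSeries-split {t = summand a (suc b) c} {u = summand (2 ℕ.+ a) (5 ℕ.+ b) (6 ℕ.+ c)}
    raise₂ 2 (2 ℕ.+ b) zSeries-raise₂ (summand-split₂ a b c)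

  F-split₃ : ∀ a b c → F a b c ≗₂ F a b (suc c) ⊕₂ z^ 3 ⊙ q^ (3 ℕ.+ c) ⊙ F (3 ℕ.+ a) (6 ℕ.+ b) (9 ℕ.+ c)
  F-split₃ a b c = zSeries-split {t = summand a b (suc c)} {u = summand (3 ℕ.+ a) (6 ℕ.+ b) (9 ℕ.+ c)}
    raise₃ 3 (3 ℕ.+ c) zSeries-raise₃ (summand-split₃ a b c)

  F-σ : ∀ a b c → F (suc a) (2 ℕ.+ b) (3 ℕ.+ c) ≗₂ F a b c [z≔zq]
  F-σ a b c m n = trans (zSeries-cong (λ i j k n → trans (cong (λ e → (q^ e · invPoch i j k) n) (exponent-σ a b c i j k))
                                                         (q^-+ (weight i j k) (exponent a b c i j k) (invPoch i j k) n)) m n)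
                        (zSeries-q^weight (summand a b c) m n)

  F-at-z⁰ : ∀ a b c → F a b c 0 ≗ one
  F-at-z⁰ a b c n = begin
    F a b c 0 n                                       ≡⟨ zSeries-at-0 (summand a b c) n ⟩
    (q^ exponent a b c 0 0 0 · invPoch 0 0 0) n       ≡⟨ cong (λ e → (q^ e · invPoch 0 0 0) n) (exponent-origin a b c) ⟩
    invPoch 0 0 0 n                                   ≡⟨ invPoch-000 n ⟩
    one n                                             ∎

  C₂-double : ∀ n → 2 ℕ.* C₂ n ℕ.+ n ≡ n ℕ.* n
  C₂-double zero    = refl
  C₂-double (suc n) = begin
    2 ℕ.* (n ℕ.+ C₂ n) ℕ.+ suc n
      ≡⟨ solve 2 (λ n X → con 2 :* (n :+ X) :+ (con 1 :+ n) := con 1 :+ n :+ n :+ (con 2 :* X :+ n)) refl n (C₂ n) ⟩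
    suc n ℕ.+ n ℕ.+ (2 ℕ.* C₂ n ℕ.+ n)    ≡⟨ cong (suc n ℕ.+ n ℕ.+_) (C₂-double n) ⟩
    suc n ℕ.+ n ℕ.+ n ℕ.* n               ≡⟨ solve 1 (λ n → con 1 :+ n :+ n :+ n :* n := (con 1 :+ n) :* (con 1 :+ n)) refl n ⟩
    suc n ℕ.* suc n                       ∎

  expo-numerator : ∀ i j k → let M = weight i j k in
    i ℕ.* (i ℕ.+ 3) ℕ.+ j ℕ.* (j ℕ.+ 5) ℕ.+ 6 ℕ.* k ℕ.+ M ℕ.* M ≡ exponent 0 0 0 i j k ℕ.* 2 ℕ.+ 3 ℕ.* M
  expo-numerator i j k = sym (begin
    exponent 0 0 0 i j k ℕ.* 2 ℕ.+ 3 ℕ.* M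
      ≡⟨ solve 6 (λ i j k X Y Z →
                   (X :+ ((i :+ Y) :+ (j :+ Z) :+ con 0 :* i :+ con 0 :* j :+ con 0 :* k)) :* con 2
                     :+ con 3 :* (i :+ con 2 :* j :+ con 3 :* k) :=
                   (con 2 :* X :+ (i :+ con 2 :* j :+ con 3 :* k)) :+ (con 2 :* Y :+ i) :+ (con 2 :* Z :+ j)
                     :+ (con 2 :* (i :+ con 2 :* j :+ con 3 :* k) :+ i :+ j))
                 refl i j k (C₂ M) (C₂ i) (C₂ j) ⟩
    (2 ℕ.* C₂ M ℕ.+ M) ℕ.+ (2 ℕ.* C₂ i ℕ.+ i) ℕ.+ (2 ℕ.* C₂ j ℕ.+ j) ℕ.+ (2 ℕ.* M ℕ.+ i ℕ.+ j)
      ≡⟨ cong₂ ℕ._+_ (cong₂ ℕ._+_ (cong₂ ℕ._+_ (C₂-double M) (C₂-double i)) (C₂-double j)) refl ⟩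
    M ℕ.* M ℕ.+ i ℕ.* i ℕ.+ j ℕ.* j ℕ.+ (2 ℕ.* M ℕ.+ i ℕ.+ j)
      ≡⟨ solve 3 (λ i j k → let M = i :+ con 2 :* j :+ con 3 :* k in
                    M :* M :+ i :* i :+ j :* j :+ (con 2 :* M :+ i :+ j) :=
                    i :* (i :+ con 3) :+ j :* (j :+ con 5) :+ con 6 :* k :+ M :* M) refl i j k ⟩
    i ℕ.* (i ℕ.+ 3) ℕ.+ j ℕ.* (j ℕ.+ 5) ℕ.+ 6 ℕ.* k ℕ.+ M ℕ.* M
      ∎)
    where M = weight i j k

  expo≡exponent : ∀ i j k → expo i j k ≡ + exponent 0 0 0 i j k
  expo≡exponent i j k = begin
    expo i j k                ≡⟨ cong (_/ℕ 2) numerator ⟩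
    + (E ℕ.* 2) /ℕ 2          ≡⟨ cong +_ (m*n/n≡m E 2) ⟩
    + E                       ∎
    where
    M = weight i j k
    E = exponent 0 0 0 i j k
    A = i ℕ.* (i ℕ.+ 3) ℕ.+ j ℕ.* (j ℕ.+ 5) ℕ.+ 6 ℕ.* k
    numerator : + (i ℕ.* (i ℕ.+ 3)) + + (j ℕ.* (j ℕ.+ 5)) + + (6 ℕ.* k) + + M * (+ M - + 3) ≡ + (E ℕ.* 2)
    numerator = begin
      + (i ℕ.* (i ℕ.+ 3)) + + (j ℕ.* (j ℕ.+ 5)) + + (6 ℕ.* k) + + M * (+ M - + 3)
        ≡⟨ cong₂ _+_ (sym (trans (pos-+ (i ℕ.* (i ℕ.+ 3) ℕ.+ j ℕ.* (j ℕ.+ 5)) (6 ℕ.* k))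
                                 (cong (_+ + (6 ℕ.* k)) (pos-+ (i ℕ.* (i ℕ.+ 3)) _))))
                     (trans (*-distribˡ-+ (+ M) (+ M) (- + 3))
                            (cong (_+_ (+ M * + M)) (trans (*-comm (+ M) (- + 3)) (sym (neg-distribˡ-* (+ 3) (+ M)))))) ⟩
      + A + (+ M * + M - + 3 * + M)
        ≡⟨ sym (+-assoc (+ A) (+ M * + M) _) ⟩
      + A + + M * + M - + 3 * + M
        ≡⟨ cong₂ _-_ (trans (cong (_+_ (+ A)) (sym (pos-* M M))) (sym (pos-+ A (M ℕ.* M)))) (sym (pos-* 3 M)) ⟩
      + (A ℕ.+ M ℕ.* M) - + (3 ℕ.* M)
        ≡⟨ cong (λ x → + x - + (3 ℕ.* M)) (expo-numerator i j k) ⟩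
      + (E ℕ.* 2 ℕ.+ 3 ℕ.* M) - + (3 ℕ.* M)
        ≡⟨ m-n≡m⊖n (E ℕ.* 2 ℕ.+ 3 ℕ.* M) (3 ℕ.* M) ⟩
      (E ℕ.* 2 ℕ.+ 3 ℕ.* M) ⊖ (3 ℕ.* M)
        ≡⟨ ⊖-≥ (ℕₚ.m≤n+m (3 ℕ.* M) (E ℕ.* 2)) ⟩
      + (E ℕ.* 2 ℕ.+ 3 ℕ.* M ∸ 3 ℕ.* M)
        ≡⟨ cong +_ (ℕₚ.m+n∸n≡m (E ℕ.* 2) (3 ℕ.* M)) ⟩
      + (E ℕ.* 2)
        ∎

  shiftZ-pos : ∀ e g n → shiftZ (+ e) g n ≡ (q^ e · g) n
  shiftZ-pos e g n with + e ℤ.≤? + n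
  ... | yes (+≤+ e≤n) rewrite ≤ᵇ-true e≤n = cong (g ∘ ℤ.∣_∣) (trans (m-n≡m⊖n n e) (⊖-≥ e≤n))
  ... | no  e≰n       rewrite ≤ᵇ-false {e} {n} (ℕₚ.≰⇒> (e≰n ∘ +≤+)) = refl

  rhsCoeff≡F : ∀ m n → rhsCoeff m n ≡ F 0 0 0 m n
  rhsCoeff≡F m n = begin
    rhsCoeff m n
      ≡⟨ sum-map-upTo (λ i → sum (map (λ j → sum (map (t i j) (upTo (suc m)))) (upTo (suc m)))) (suc m) ⟩
    ∑[ i < suc m ] sum (map (λ j → sum (map (t i j) (upTo (suc m)))) (upTo (suc m)))
      ≡⟨ ∑-cong (suc m) (λ i _ → trans (sum-map-upTo (λ j → sum (map (t i j) (upTo (suc m)))) (suc m))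
                                       (∑-cong (suc m) λ j _ → sum-map-upTo (t i j) (suc m))) ⟩
    box (suc m) (suc m) (suc m) t
      ≡⟨ ∑-cong (suc m) (λ i _ → ∑-cong (suc m) λ j _ → ∑-cong (suc m) λ k _ →
           cong (λ x → if weight i j k ≡ᵇ m then x else + 0) (term≡summand i j k)) ⟩
    F 0 0 0 m n
      ∎
    where
    t : ℕ → ℕ → ℕ → ℤ
    t i j k = if weight i j k ≡ᵇ m then term i j k n else + 0
    term≡summand : ∀ i j k → term i j k n ≡ summand 0 0 0 i j k n
    term≡summand i j k = trans (cong (λ e → shiftZ e (invPoch i j k) n) (expo≡exponent i j k))
                               (shiftZ-pos (exponent 0 0 0 i j k) (invPoch i j k) n)

  Term : Set
  Term = ℕ × ℕ × ℕ × ℕ × ℕ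

  ⟦_⟧ : Term → Series₂
  ⟦ k , l , a , b , c ⟧ = z^ k ⊙ q^ l ⊙ F a b c

  ⟦_⟧* : List Term → Series₂
  ⟦ []     ⟧* m n = + 0
  ⟦ t ∷ ts ⟧* m n = ⟦ t ⟧ m n + ⟦ ts ⟧* m n

  ⟦⟧*-++ : ∀ xs ys → ⟦ xs ++ ys ⟧* ≗₂ ⟦ xs ⟧* ⊕₂ ⟦ ys ⟧*
  ⟦⟧*-++ []       ys m n = sym (+-identityˡ _)
  ⟦⟧*-++ (x ∷ xs) ys m n = trans (cong (_+_ (⟦ x ⟧ m n)) (⟦⟧*-++ xs ys m n)) (sym (+-assoc (⟦ x ⟧ m n) _ _))

  z^q^-split : ∀ k l d e {X Y Z} → X ≗₂ Y ⊕₂ z^ d ⊙ q^ e ⊙ Z →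
    z^ k ⊙ q^ l ⊙ X ≗₂ z^ k ⊙ q^ l ⊙ Y ⊕₂ z^ (k ℕ.+ d) ⊙ q^ (l ℕ.+ e) ⊙ Z
  z^q^-split k l d e {X} {Y} {Z} X≗ m n = begin
    (z^ k ⊙ q^ l ⊙ X) m n
      ≡⟨ z^-cong k (q^⊙-cong l X≗) m n ⟩
    (z^ k ⊙ q^ l ⊙ (Y ⊕₂ z^ d ⊙ q^ e ⊙ Z)) m n
      ≡⟨ z^-cong k (q^⊙-⊕ l Y (z^ d ⊙ q^ e ⊙ Z)) m n ⟩
    (z^ k ⊙ (q^ l ⊙ Y ⊕₂ q^ l ⊙ z^ d ⊙ q^ e ⊙ Z)) m n
      ≡⟨ z^-⊕ k (q^ l ⊙ Y) (q^ l ⊙ z^ d ⊙ q^ e ⊙ Z) m n ⟩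
    (z^ k ⊙ q^ l ⊙ Y) m n + (z^ k ⊙ q^ l ⊙ z^ d ⊙ q^ e ⊙ Z) m n
      ≡⟨ cong (_+_ ((z^ k ⊙ q^ l ⊙ Y) m n)) (begin
           (z^ k ⊙ q^ l ⊙ z^ d ⊙ q^ e ⊙ Z) m n     ≡⟨ z^-cong k (q^⊙-z^ l d (q^ e ⊙ Z)) m n ⟩
           (z^ k ⊙ z^ d ⊙ q^ l ⊙ q^ e ⊙ Z) m n     ≡⟨ sym (z^-+ k d (q^ l ⊙ q^ e ⊙ Z) m n) ⟩
           (z^ (k ℕ.+ d) ⊙ q^ l ⊙ q^ e ⊙ Z) m n    ≡⟨ z^-cong (k ℕ.+ d) (λ m n → sym (q^⊙-+ l e Z m n)) m n ⟩
           (z^ (k ℕ.+ d) ⊙ q^ (l ℕ.+ e) ⊙ Z) m n   ∎) ⟩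
    (z^ k ⊙ q^ l ⊙ Y) m n + (z^ (k ℕ.+ d) ⊙ q^ (l ℕ.+ e) ⊙ Z) m n
      ∎

  data Axis : Set where
    ax₁ ax₂ ax₃ : Axis

  kept moved : Axis → Term → Term
  kept ax₁ (k , l , a , b , c) = (k , l , suc a , b , c)
  kept ax₂ (k , l , a , b , c) = (k , l , a , suc b , c)
  kept ax₃ (k , l , a , b , c) = (k , l , a , b , suc c)
  moved ax₁ (k , l , a , b , c) = (k ℕ.+ 1 , l ℕ.+ suc a       , 2 ℕ.+ a , 2 ℕ.+ b , 3 ℕ.+ c)
  moved ax₂ (k , l , a , b , c) = (k ℕ.+ 2 , l ℕ.+ (2 ℕ.+ b) , 2 ℕ.+ a , 5 ℕ.+ b , 6 ℕ.+ c)
  moved ax₃ (k , l , a , b , c) = (k ℕ.+ 3 , l ℕ.+ (3 ℕ.+ c) , 3 ℕ.+ a , 6 ℕ.+ b , 9 ℕ.+ c)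

  split-sound : ∀ x t → ⟦ t ⟧ ≗₂ ⟦ kept x t ⟧ ⊕₂ ⟦ moved x t ⟧
  split-sound ax₁ (k , l , a , b , c) =
    z^q^-split k l 1 (suc a) {Y = F (suc a) b c} {Z = F (2 ℕ.+ a) (2 ℕ.+ b) (3 ℕ.+ c)} (F-split₁ a b c)
  split-sound ax₂ (k , l , a , b , c) =
    z^q^-split k l 2 (2 ℕ.+ b) {Y = F a (suc b) c} {Z = F (2 ℕ.+ a) (5 ℕ.+ b) (6 ℕ.+ c)} (F-split₂ a b c)
  split-sound ax₃ (k , l , a , b , c) =
    z^q^-split k l 3 (3 ℕ.+ c) {Y = F a b (suc c)} {Z = F (3 ℕ.+ a) (6 ℕ.+ b) (9 ℕ.+ c)} (F-split₃ a b c)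

  _≟ₜ_ : DecidableEquality Term
  _≟ₜ_ = ≡-dec ℕₚ._≟_ (≡-dec ℕₚ._≟_ (≡-dec ℕₚ._≟_ (≡-dec ℕₚ._≟_ ℕₚ._≟_)))

  remove : Term → List Term → Maybe (List Term)
  remove t []       = nothing
  remove t (u ∷ us) with t ≟ₜ u
  ... | yes _ = just us
  ... | no  _ = Maybe.map (u ∷_) (remove t us)

  remove-sound : ∀ t us {vs} → remove t us ≡ just vs → ⟦ us ⟧* ≗₂ ⟦ t ⟧ ⊕₂ ⟦ vs ⟧*
  remove-sound t (u ∷ us) eq m n with t ≟ₜ u
  remove-sound t (u ∷ us) refl m n | yes refl = refl
  remove-sound t (u ∷ us) eq   m n | no  _ with remove t us in eq′
  remove-sound t (u ∷ us) refl m n | no  _ | just ws = begin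
    ⟦ u ⟧ m n + ⟦ us ⟧* m n                ≡⟨ cong (_+_ (⟦ u ⟧ m n)) (remove-sound t us eq′ m n) ⟩
    ⟦ u ⟧ m n + (⟦ t ⟧ m n + ⟦ ws ⟧* m n)  ≡⟨ x∙yz≈y∙xz (⟦ u ⟧ m n) (⟦ t ⟧ m n) (⟦ ws ⟧* m n) ⟩
    ⟦ t ⟧ m n + (⟦ u ⟧ m n + ⟦ ws ⟧* m n)  ∎

  sameTerms : List Term → List Term → Bool
  sameTerms []       ys = null ys
  sameTerms (x ∷ xs) ys with remove x ys
  ... | just ys′ = sameTerms xs ys′
  ... | nothing  = false

  sameTerms-sound : ∀ xs ys → T (sameTerms xs ys) → ⟦ xs ⟧* ≗₂ ⟦ ys ⟧*
  sameTerms-sound []       []       _  m n = refl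
  sameTerms-sound (x ∷ xs) ys       ok m n with remove x ys in eq
  ... | just ys′ = trans (cong (_+_ (⟦ x ⟧ m n)) (sameTerms-sound xs ys′ ok m n)) (sym (remove-sound x ys eq m n))

  Step : Set
  Step = Axis × Term

  applySteps : List Step → List Term → Maybe (List Term)
  applySteps []             xs = just xs
  applySteps ((x , t) ∷ ss) xs with remove t xs
  ... | just ys = applySteps ss (kept x t ∷ moved x t ∷ ys)
  ... | nothing = nothing

  applySteps-sound : ∀ ss xs {ys} → applySteps ss xs ≡ just ys → ⟦ xs ⟧* ≗₂ ⟦ ys ⟧*
  applySteps-sound []             xs refl m n = refl
  applySteps-sound ((x , t) ∷ ss) xs {ys} eq m n with remove t xs in eq′
  ... | just zs = begin
    ⟦ xs ⟧* m n                                          ≡⟨ remove-sound t xs eq′ m n ⟩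
    ⟦ t ⟧ m n + ⟦ zs ⟧* m n                              ≡⟨ cong (_+ ⟦ zs ⟧* m n) (split-sound x t m n) ⟩
    ⟦ kept x t ⟧ m n + ⟦ moved x t ⟧ m n + ⟦ zs ⟧* m n   ≡⟨ +-assoc (⟦ kept x t ⟧ m n) (⟦ moved x t ⟧ m n) (⟦ zs ⟧* m n) ⟩
    ⟦ kept x t ∷ moved x t ∷ zs ⟧* m n                   ≡⟨ applySteps-sound ss (kept x t ∷ moved x t ∷ zs) eq m n ⟩
    ⟦ ys ⟧* m n                                          ∎

  Certificate : Set
  Certificate = List Step × List Step

  verify : List Term → List Term → Certificate → Bool
  verify xs ys (sx , sy) with applySteps sx xs | applySteps sy ys
  ... | just xs′ | just ys′ = sameTerms xs′ ys′
  ... | _        | _        = false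

  verify-sound : ∀ xs ys c → T (verify xs ys c) → ⟦ xs ⟧* ≗₂ ⟦ ys ⟧*
  verify-sound xs ys (sx , sy) ok m n with applySteps sx xs in ex | applySteps sy ys in ey
  ... | just xs′ | just ys′ = trans (applySteps-sound sx xs ex m n)
                                    (trans (sameTerms-sound xs′ ys′ ok m n) (sym (applySteps-sound sy ys ey m n)))

  -- coefficient of z^M q^n in (zq)^f X(zq, q)
  rescaled : ℕ → Series₂ → Series₂
  rescaled f X M n = if M ≤ᵇ n then (if f ≤ᵇ M then X (M ∸ f) (n ∸ M) else + 0) else + 0

  rescaled-shift : ∀ f X → rescaled f X ≗₂ z^ f ⊙ q^ f ⊙ X [z≔zq]
  rescaled-shift f X M n with f ≤ᵇ M | ℕₚ.≤ᵇ-reflects-≤ f M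
  ... | false | _       = if-eta (M ≤ᵇ n)
  ... | true  | ofʸ f≤M = begin
    (q^ M · X (M ∸ f)) n                     ≡⟨ cong (λ e → (q^ e · X (M ∸ f)) n) (sym (ℕₚ.m+[n∸m]≡n f≤M)) ⟩
    (q^ (f ℕ.+ (M ∸ f)) · X (M ∸ f)) n       ≡⟨ q^-+ f (M ∸ f) (X (M ∸ f)) n ⟩
    (q^ f · q^ (M ∸ f) · X (M ∸ f)) n        ∎

  rescaled-⊕ : ∀ f X Y → rescaled f (X ⊕₂ Y) ≗₂ rescaled f X ⊕₂ rescaled f Y
  rescaled-⊕ f X Y M n with M ≤ᵇ n | f ≤ᵇ M
  ... | true  | true  = refl
  ... | true  | false = refl
  ... | false | _     = refl

  step : (ℕ → ℕ → Series₂) → ℕ → ℕ → Series₂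
  step Y p r M n = ∑[ f < 4 ∸ (p ℕ.+ r) ] rescaled f (Y f p) M n

  record IsSolution (Y : ℕ → ℕ → Series₂) : Set where
    field
      recurrence : ∀ p r → p ℕ.+ r ℕ.≤ 3 → Y p r ≗₂ step Y p r
      initial    : ∀ p r → p ℕ.+ r ℕ.≤ 3 → Y p r 0 ≗ one

  solution-unique : ∀ {X Y} → IsSolution X → IsSolution Y → ∀ p r → p ℕ.+ r ℕ.≤ 3 → X p r ≗₂ Y p r
  solution-unique {X} {Y} X-sol Y-sol p r p+r≤3 m n = below (suc n) p r p+r≤3 m n ℕₚ.≤-refl
    where
    module X = IsSolution X-sol
    module Y = IsSolution Y-sol
    below : ∀ b p r → p ℕ.+ r ℕ.≤ 3 → ∀ m n → n ℕ.< b → X p r m n ≡ Y p r m n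
    below (suc b) p r p+r≤3 zero    n _   = trans (X.initial p r p+r≤3 n) (sym (Y.initial p r p+r≤3 n))
    below (suc b) p r p+r≤3 (suc m) n n≤b = begin
      X p r (suc m) n      ≡⟨ X.recurrence p r p+r≤3 (suc m) n ⟩
      step X p r (suc m) n ≡⟨ ∑-cong (4 ∸ (p ℕ.+ r)) (λ f f<4∸ →
                                agree f (ℕₚ.≤-trans (ℕₚ.m≤m+n (f ℕ.+ p) r) (<4∸⇒+≤3 f p r p+r≤3 f<4∸))) ⟩
      step Y p r (suc m) n ≡⟨ sym (Y.recurrence p r p+r≤3 (suc m) n) ⟩
      Y p r (suc m) n      ∎
      where
      agree : ∀ f → f ℕ.+ p ℕ.≤ 3 → rescaled f (X f p) (suc m) n ≡ rescaled f (Y f p) (suc m) n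
      agree f f+p≤3 with suc m ≤ᵇ n | ℕₚ.≤ᵇ-reflects-≤ (suc m) n | f ≤ᵇ suc m
      ... | false | _        | _     = refl
      ... | true  | ofʸ m<n  | false = refl
      ... | true  | ofʸ m<n  | true  = below b f p f+p≤3 (suc m ∸ f) (n ∸ suc m)
                                        (ℕₚ.<-≤-trans (ℕₚ.∸-monoʳ-< {n} {suc m} {0} (s≤s z≤n) m<n) (ℕₚ.≤-pred n≤b))

  rescale : ℕ → Term → Term
  rescale f (k , l , a , b , c) = (f ℕ.+ k , f ℕ.+ (l ℕ.+ k) , suc a , 2 ℕ.+ b , 3 ℕ.+ c)

  rescale-sound : ∀ f t → ⟦ rescale f t ⟧ ≗₂ rescaled f ⟦ t ⟧
  rescale-sound f (k , l , a , b , c) m n = begin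
    (z^ (f ℕ.+ k) ⊙ q^ (f ℕ.+ (l ℕ.+ k)) ⊙ F′) m n
      ≡⟨ z^-+ f k (q^ (f ℕ.+ (l ℕ.+ k)) ⊙ F′) m n ⟩
    (z^ f ⊙ z^ k ⊙ q^ (f ℕ.+ (l ℕ.+ k)) ⊙ F′) m n
      ≡⟨ z^-cong f (z^-cong k (q^⊙-+ f (l ℕ.+ k) F′)) m n ⟩
    (z^ f ⊙ z^ k ⊙ q^ f ⊙ q^ (l ℕ.+ k) ⊙ F′) m n
      ≡⟨ z^-cong f (λ m n → sym (q^⊙-z^ f k (q^ (l ℕ.+ k) ⊙ F′) m n)) m n ⟩
    (z^ f ⊙ q^ f ⊙ z^ k ⊙ q^ (l ℕ.+ k) ⊙ F′) m n
      ≡⟨ z^-cong f (q^⊙-cong f (z^-cong k (q^⊙-cong (l ℕ.+ k) (F-σ a b c)))) m n ⟩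
    (z^ f ⊙ q^ f ⊙ z^ k ⊙ q^ (l ℕ.+ k) ⊙ F a b c [z≔zq]) m n
      ≡⟨ z^-cong f (q^⊙-cong f (λ m n → sym (z^q^-[z≔zq] k l (F a b c) m n))) m n ⟩
    (z^ f ⊙ q^ f ⊙ (z^ k ⊙ q^ l ⊙ F a b c) [z≔zq]) m n
      ≡⟨ sym (rescaled-shift f (z^ k ⊙ q^ l ⊙ F a b c) m n) ⟩
    rescaled f (z^ k ⊙ q^ l ⊙ F a b c) m n
      ∎
    where F′ = F (suc a) (2 ℕ.+ b) (3 ℕ.+ c)

  ⟦⟧*-map-rescale : ∀ f ts → ⟦ map (rescale f) ts ⟧* ≗₂ rescaled f ⟦ ts ⟧*
  ⟦⟧*-map-rescale f []       m n = sym (trans (cong (λ x → if m ≤ᵇ n then x else + 0) (if-eta (f ≤ᵇ m))) (if-eta (m ≤ᵇ n)))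
  ⟦⟧*-map-rescale f (t ∷ ts) m n = trans (cong₂ _+_ (rescale-sound f t m n) (⟦⟧*-map-rescale f ts m n))
                                         (sym (rescaled-⊕ f ⟦ t ⟧ ⟦ ts ⟧* m n))

  -- ⟦ ansatz p r ⟧* is the closed form of G_{p,r}.
  ansatz : ℕ → ℕ → List Term
  ansatz 0 0 = (0 , 0 , 0 , 0 , 0) ∷ []
  ansatz 1 0 = (0 , 0 , 1 , 0 , 2) ∷ (1 , 1 , 2 , 4 , 6) ∷ []
  ansatz 2 0 = (0 , 0 , 0 , 3 , 4) ∷ []
  ansatz 3 0 = (0 , 0 , 2 , 4 , 6) ∷ []
  ansatz 0 1 = (0 , 0 , 0 , 0 , 1) ∷ []
  ansatz 1 1 = (0 , 0 , 1 , 1 , 3) ∷ (1 , 1 , 2 , 4 , 6) ∷ []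
  ansatz 2 1 = (0 , 0 , 1 , 3 , 5) ∷ []
  ansatz 0 2 = (0 , 0 , 0 , 1 , 2) ∷ []
  ansatz 1 2 = (0 , 0 , 1 , 2 , 4) ∷ []
  ansatz 0 3 = (0 , 0 , 1 , 2 , 3) ∷ []
  ansatz _ _ = []

  stepTerms : ℕ → ℕ → List Term
  stepTerms p r = concatMap (λ f → map (rescale f) (ansatz f p)) (upTo (4 ∸ (p ℕ.+ r)))

  ⟦⟧*-concatMap : ∀ (g : ℕ → List Term) N m n → ⟦ concatMap g (upTo N) ⟧* m n ≡ ∑[ f < N ] ⟦ g f ⟧* m n
  ⟦⟧*-concatMap g N m n = go g N
    where
    go : ∀ (g : ℕ → List Term) N {h : ℕ → ℕ} → ⟦ concatMap g (applyUpTo h N) ⟧* m n ≡ ∑[ f < N ] ⟦ g (h f) ⟧* m n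
    go g zero    = refl
    go g (suc N) {h} = trans (⟦⟧*-++ (g (h 0)) _ m n) (cong (_+_ (⟦ g (h 0) ⟧* m n)) (go g N))

  stepTerms-sound : ∀ p r → ⟦ stepTerms p r ⟧* ≗₂ step (λ p r → ⟦ ansatz p r ⟧*) p r
  stepTerms-sound p r m n = trans (⟦⟧*-concatMap (λ f → map (rescale f) (ansatz f p)) (4 ∸ (p ℕ.+ r)) m n)
                                  (∑-cong (4 ∸ (p ℕ.+ r)) λ f _ → ⟦⟧*-map-rescale f (ansatz f p) m n)

  by-state : {P : ℕ → ℕ → Set} → P 0 0 → P 1 0 → P 2 0 → P 3 0 → P 0 1 → P 1 1 → P 2 1 → P 0 2 → P 1 2 → P 0 3 →
    ∀ p r → p ℕ.+ r ℕ.≤ 3 → P p r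
  by-state P00 P10 P20 P30 P01 P11 P21 P02 P12 P03 = λ where
    0 0 _ → P00
    1 0 _ → P10
    2 0 _ → P20
    3 0 _ → P30
    0 1 _ → P01
    1 1 _ → P11
    2 1 _ → P21
    0 2 _ → P02
    1 2 _ → P12
    0 3 _ → P03
    4 0 (s≤s (s≤s (s≤s ())))
    (suc (suc (suc (suc (suc p))))) r (s≤s (s≤s (s≤s ())))
    3 (suc r) (s≤s (s≤s (s≤s ())))
    2 (suc (suc r)) (s≤s (s≤s (s≤s ())))
    1 (suc (suc (suc r))) (s≤s (s≤s (s≤s ())))
    0 (suc (suc (suc (suc r)))) (s≤s (s≤s (s≤s ())))

  -- steps rewriting ansatz p r and stepTerms p r into the same multiset of terms
  certificate : ℕ → ℕ → Certificate
  certificate 0 0 =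
    ( (ax₁ , 0 , 0 , 0 , 0 , 0) ∷ (ax₂ , 0 , 0 , 1 , 0 , 0) ∷ (ax₂ , 0 , 0 , 1 , 1 , 0) ∷ (ax₃ , 0 , 0 , 1 , 2 , 0) ∷
      (ax₃ , 0 , 0 , 1 , 2 , 1) ∷ (ax₃ , 0 , 0 , 1 , 2 , 2) ∷ (ax₃ , 1 , 1 , 2 , 2 , 3) ∷ (ax₃ , 1 , 1 , 2 , 2 , 4) ∷
      (ax₃ , 2 , 2 , 3 , 5 , 6) ∷ (ax₃ , 2 , 3 , 3 , 6 , 6) ∷ (ax₃ , 2 , 3 , 3 , 6 , 7) ∷ (ax₃ , 2 , 3 , 3 , 6 , 8) ∷
      (ax₂ , 4 , 8 , 5 , 8 , 13) ∷ (ax₂ , 6 , 18 , 7 , 13 , 19) ∷ []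
    , (ax₁ , 2 , 2 , 1 , 5 , 7) ∷ (ax₁ , 2 , 2 , 2 , 5 , 7) ∷ (ax₁ , 3 , 3 , 3 , 6 , 9) ∷ (ax₂ , 3 , 3 , 4 , 6 , 9) ∷
      (ax₂ , 3 , 3 , 4 , 7 , 9) ∷ (ax₁ , 3 , 4 , 3 , 7 , 10) ∷ (ax₂ , 3 , 4 , 4 , 7 , 10) ∷ (ax₂ , 3 , 5 , 4 , 7 , 10) ∷
      (ax₃ , 3 , 5 , 4 , 8 , 10) ∷ (ax₃ , 5 , 14 , 6 , 12 , 16) ∷ [] )
  certificate 1 0 =
    ( (ax₂ , 0 , 0 , 1 , 0 , 2) ∷ (ax₂ , 0 , 0 , 1 , 1 , 2) ∷ (ax₃ , 0 , 0 , 1 , 2 , 2) ∷ (ax₃ , 0 , 0 , 1 , 2 , 3) ∷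
      (ax₃ , 2 , 3 , 3 , 6 , 8) ∷ []
    , (ax₂ , 1 , 1 , 2 , 3 , 6) ∷ (ax₁ , 2 , 2 , 2 , 5 , 8) ∷ (ax₂ , 3 , 5 , 4 , 7 , 11) ∷ [] )
  certificate 2 0 =
    ( (ax₁ , 0 , 0 , 0 , 3 , 4) ∷ (ax₃ , 0 , 0 , 1 , 3 , 4) ∷ []
    , (ax₂ , 1 , 1 , 2 , 4 , 7) ∷ [] )
  certificate 0 1 =
    ( (ax₁ , 0 , 0 , 0 , 0 , 1) ∷ (ax₂ , 0 , 0 , 1 , 0 , 1) ∷ (ax₂ , 0 , 0 , 1 , 1 , 1) ∷ (ax₃ , 0 , 0 , 1 , 2 , 1) ∷
      (ax₃ , 0 , 0 , 1 , 2 , 2) ∷ (ax₃ , 1 , 1 , 2 , 2 , 4) ∷ (ax₃ , 2 , 3 , 3 , 6 , 7) ∷ (ax₃ , 2 , 3 , 3 , 6 , 8) ∷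
      (ax₂ , 4 , 8 , 5 , 8 , 13) ∷ (ax₂ , 6 , 18 , 7 , 13 , 19) ∷ []
    , (ax₁ , 2 , 2 , 1 , 5 , 7) ∷ (ax₁ , 2 , 2 , 2 , 5 , 7) ∷ (ax₁ , 3 , 4 , 3 , 7 , 10) ∷ (ax₂ , 3 , 4 , 4 , 7 , 10) ∷
      (ax₂ , 3 , 5 , 4 , 7 , 10) ∷ (ax₃ , 3 , 5 , 4 , 8 , 10) ∷ (ax₃ , 5 , 14 , 6 , 12 , 16) ∷ [] )
  certificate 1 1 =
    ( (ax₂ , 0 , 0 , 1 , 1 , 3) ∷ (ax₃ , 0 , 0 , 1 , 2 , 3) ∷ []
    , (ax₂ , 1 , 1 , 2 , 3 , 6) ∷ [] )
  certificate 0 2 =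
    ( (ax₁ , 0 , 0 , 0 , 1 , 2) ∷ (ax₂ , 0 , 0 , 1 , 1 , 2) ∷ (ax₃ , 0 , 0 , 1 , 2 , 2) ∷ (ax₃ , 2 , 3 , 3 , 6 , 8) ∷ []
    , (ax₂ , 1 , 1 , 2 , 2 , 5) ∷ (ax₂ , 3 , 5 , 4 , 7 , 11) ∷ [] )
  certificate _ _ = [] , []

  certified : ∀ p r → p ℕ.+ r ℕ.≤ 3 → T (verify (ansatz p r) (stepTerms p r) (certificate p r))
  certified = by-state _ _ _ _ _ _ _ _ _ _

  vanish-at-z⁰ : ∀ ts → All (λ t → 1 ℕ.≤ proj₁ t) ts → ⟦ ts ⟧* 0 ≗ λ _ → + 0
  vanish-at-z⁰ []       []             n = refl
  vanish-at-z⁰ (t ∷ ts) (s≤s z≤n ∷ ks) n = trans (+-identityˡ (⟦ ts ⟧* 0 n)) (vanish-at-z⁰ ts ks n)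

  ⟦⟧*-at-z⁰ : ∀ a b c ts → All (λ t → 1 ℕ.≤ proj₁ t) ts → ⟦ (0 , 0 , a , b , c) ∷ ts ⟧* 0 ≗ one
  ⟦⟧*-at-z⁰ a b c ts ks n = trans (cong₂ _+_ (F-at-z⁰ a b c n) (vanish-at-z⁰ ts ks n)) (+-identityʳ (one n))

  ansatz-solution : IsSolution (λ p r → ⟦ ansatz p r ⟧*)
  ansatz-solution .IsSolution.recurrence p r p+r≤3 m n =
    trans (verify-sound (ansatz p r) (stepTerms p r) (certificate p r) (certified p r p+r≤3) m n) (stepTerms-sound p r m n)
  ansatz-solution .IsSolution.initial = by-state
    (⟦⟧*-at-z⁰ 0 0 0 [] []) (⟦⟧*-at-z⁰ 1 0 2 ((1 , 1 , 2 , 4 , 6) ∷ []) (s≤s z≤n ∷ []))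
    (⟦⟧*-at-z⁰ 0 3 4 [] []) (⟦⟧*-at-z⁰ 2 4 6 [] [])
    (⟦⟧*-at-z⁰ 0 0 1 [] []) (⟦⟧*-at-z⁰ 1 1 3 ((1 , 1 , 2 , 4 , 6) ∷ []) (s≤s z≤n ∷ [])) (⟦⟧*-at-z⁰ 1 3 5 [] [])
    (⟦⟧*-at-z⁰ 0 1 2 [] []) (⟦⟧*-at-z⁰ 1 2 4 [] []) (⟦⟧*-at-z⁰ 1 2 3 [] [])

  pos-sum : ∀ (g : ℕ → ℕ) xs → + sumℕ (map g xs) ≡ sum (map (λ x → + g x) xs)
  pos-sum g []       = refl
  pos-sum g (x ∷ xs) = trans (pos-+ (g x) _) (cong (_+_ (+ g x)) (pos-sum g xs))

  counts-solution : IsSolution (λ p r m n → + count p r m n)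
  counts-solution .IsSolution.recurrence p r p+r≤3 M n = begin
    + count p r M n
      ≡⟨ cong +_ (count-rec p r M n p+r≤3) ⟩
    + sumℕ (map g (upTo (4 ∸ (p ℕ.+ r))))
      ≡⟨ trans (pos-sum g (upTo (4 ∸ (p ℕ.+ r)))) (sum-map-upTo (λ f → + g f) (4 ∸ (p ℕ.+ r))) ⟩
    ∑[ f < 4 ∸ (p ℕ.+ r) ] + g f
      ≡⟨ ∑-cong (4 ∸ (p ℕ.+ r)) (λ f _ → trans (if-float +_ (M ≤ᵇ n))
                                                (cong (λ x → if M ≤ᵇ n then x else + 0) (if-float +_ (f ≤ᵇ M)))) ⟩
    step (λ p r m n → + count p r m n) p r M n
      ∎
    where
    g : ℕ → ℕ
    g f = if M ≤ᵇ n then (if f ≤ᵇ M then count f p (M ∸ f) (n ∸ M) else 0) else 0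
  counts-solution .IsSolution.initial p r p+r≤3 zero    = cong +_ (count-at-z⁰ p r p+r≤3)
  counts-solution .IsSolution.initial p r p+r≤3 (suc n) = refl

open import Data.Integer using (+_)
open Partitions using (count; c′≡count)
open QSeries using (F; ⟦_⟧*; ansatz; solution-unique; counts-solution; ansatz-solution; rhsCoeff≡F)
open import Data.Integer.Properties using (+-identityʳ)

corollary25 : ∀ (m n : ℕ) → + c′ m n ≡ rhsCoeff m n
corollary25 m n = begin
  + c′ m n              ≡⟨ cong +_ (c′≡count m n) ⟩
  + count 0 0 m n       ≡⟨ solution-unique counts-solution ansatz-solution 0 0 z≤n m n ⟩
  ⟦ ansatz 0 0 ⟧* m n   ≡⟨ +-identityʳ (F 0 0 0 m n) ⟩
  F 0 0 0 m n           ≡⟨ rhsCoeff≡F m n ⟨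
  rhsCoeff m n          ∎
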